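{- Let $G_1,G_2$ be cubic graphs with $K'(G_1,3)=a$ and $K'(G_2,3)=b$. Then $K'(G_1\mathbin{Y}G_2,3)=K'(G_1\mathbin{H}G_2,3)=ab$ (for any particular choice of the compositions).
   Context: Graphs are finite, may have multiple edges, and have no loops. For a proper edge coloring and two colors $a,b$, an edge-Kempe chain is a connected component of the subgraph of edges colored $a$ or $b$; an edge-Kempe switch exchanges $a$ and $b$ on one chain. Two colorings are edge-Kempe equivalent if one is obtained from the other by a finite sequence of switches. $K'(G,n)$ denotes the number of edge-Kempe equivalence classes of proper edge colorings of $G$ with colors $\{1,\dots,n\}$. $G_1\mathbin{Y}G_2$: choose a vertex $v_1$ of $G_1$ with incident edges $v_1s_{1j}$ and a vertex $v_2$ of $G_2$ with incident edges $v_2s_{2j}$ ($j=1,2,3$); delete $v_1,v_2$ from the disjoint union and add edges $s_{1j}s_{2j}$. $G_1\mathbin{H}G_2$: choose edges $s_{11}s_{12}$ of $G_1$ and $s_{21}s_{22}$ of $G_2$, delete them from the disjoint union and add $s_{11}s_{21},s_{12}s_{22}$. -}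

module Defs where

open import Data.Nat using (ℕ; suc)
open import Data.Fin using (Fin; zero; suc; _≟_)
open import Data.Vec using (Vec; lookup)
open import Data.List using (List; length; filter)
open import Data.Product using (Σ; ∃; _×_; _,_; proj₁; proj₂)
open import Data.Sum using (_⊎_; inj₁; inj₂)
open import Data.Bool using (if_then_else_)
open import Function.Bundles using (_↔_; _⇔_; Inverse)
open import Relation.Nullary using (¬_; Dec; does)
open import Relation.Nullary.Decidable using (False; _⊎-dec_)
open import Relation.Binary.PropositionalEquality using (_≡_; _≢_)
open import Relation.Binary.Construct.Closure.ReflexiveTransitive using (Star)
import Data.List as L

record Graph : Set where
  field
    V : ℕ
    E : ℕ
    ends : Fin E → Fin V × Fin V
    loopless : ∀ f → proj₁ (ends f) ≢ proj₂ (ends f)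
open Graph public

Inc : (G : Graph) → Fin (V G) → Fin (E G) → Set
Inc G v f = proj₁ (ends G f) ≡ v ⊎ proj₂ (ends G f) ≡ v

inc? : (G : Graph) (v : Fin (V G)) (f : Fin (E G)) → Dec (Inc G v f)
inc? G v f = (proj₁ (ends G f) ≟ v) ⊎-dec (proj₂ (ends G f) ≟ v)

-- degree = number of edges incident with v (no loops, so each counts once)
degree : (G : Graph) → Fin (V G) → ℕ
degree G v = length (filter (inc? G v) (L.allFin (E G)))

Cubic : Graph → Set
Cubic G = ∀ v → degree G v ≡ 3

ShareEnd : (G : Graph) → Fin (E G) → Fin (E G) → Set
ShareEnd G f g = ∃ λ v → Inc G v f × Inc G v g

Colouring : Graph → ℕ → Set
Colouring G n = Vec (Fin n) (E G)

Proper : (G : Graph) {n : ℕ} → Colouring G n → Set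
Proper G c = ∀ f g → f ≢ g → ShareEnd G f g → lookup c f ≢ lookup c g

ProperColouring : Graph → ℕ → Set
ProperColouring G n = Σ (Colouring G n) (Proper G)

InAB : ∀ {n} → Fin n → Fin n → Fin n → Set
InAB a b x = x ≡ a ⊎ x ≡ b

-- Reach G c a b f g : edge g lies in the same connected component as edge f
-- of the subgraph formed by the edges coloured a or b (f itself coloured a/b)
data Reach (G : Graph) {n : ℕ} (c : Colouring G n) (a b : Fin n) (f : Fin (E G)) :
           Fin (E G) → Set where
  here : Reach G c a b f f
  step : ∀ {g h} → Reach G c a b f g → ShareEnd G g h →
         InAB a b (lookup c h) → Reach G c a b f h

swapCol : ∀ {n} → Fin n → Fin n → Fin n → Fin n
swapCol a b x = if does (x ≟ a) then b else (if does (x ≟ b) then a else x)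

KempeSwitch : (G : Graph) {n : ℕ} → Colouring G n → Colouring G n → Set
KempeSwitch G {n} c c' =
  Σ (Fin n) λ a → Σ (Fin n) λ b → Σ (Fin (E G)) λ f →
    InAB a b (lookup c f) ×
    (∀ g → (Reach G c a b f g → lookup c' g ≡ swapCol a b (lookup c g)) ×
           (¬ Reach G c a b f g → lookup c' g ≡ lookup c g))

KempeEquiv : (G : Graph) {n : ℕ} → Colouring G n → Colouring G n → Set
KempeEquiv G = Star (KempeSwitch G)

-- K'(G,n) = k : the proper n-edge-colourings fall into exactly k
-- edge-Kempe equivalence classes (a surjection onto Fin k whose fibres
-- are exactly the classes)
KempeClasses : Graph → ℕ → ℕ → Set
KempeClasses G n k =
  Σ (ProperColouring G n → Fin k) λ cls →
    (∀ i → ∃ λ c → cls c ≡ i) ×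
    (∀ c d → (cls c ≡ cls d) ⇔ KempeEquiv G (proj₁ c) (proj₁ d))

SameEnds : {A : Set} → A × A → A × A → Set
SameEnds (x , y) (x' , y') = (x ≡ x' × y ≡ y') ⊎ (x ≡ y' × y ≡ x')

map× : {A B : Set} → (A → B) → A × A → B × B
map× h (x , y) = h x , h y

-- data for the Y-operation at a vertex v: its incident edges e j = v s j
record YPort (G : Graph) : Set where
  field
    v : Fin (V G)
    e : Fin 3 → Fin (E G)
    s : Fin 3 → Fin (V G)
    e-inj : ∀ i j → e i ≡ e j → i ≡ j
    e-ends : ∀ j → SameEnds (ends G (e j)) (v , s j)
    e-all : ∀ f → Inc G v f → ∃ λ j → e j ≡ f

OldV : (G : Graph) → Fin (V G) → Set
OldV G v = Σ (Fin (V G)) λ x → False (x ≟ v)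

OldEv : (G : Graph) → Fin (V G) → Set
OldEv G v = Σ (Fin (E G)) λ f → False (inc? G v f)

forgetY : (G₁ G₂ : Graph) (v₁ : Fin (V G₁)) (v₂ : Fin (V G₂)) →
          OldV G₁ v₁ ⊎ OldV G₂ v₂ → Fin (V G₁) ⊎ Fin (V G₂)
forgetY G₁ G₂ v₁ v₂ (inj₁ (x , _)) = inj₁ x
forgetY G₁ G₂ v₁ v₂ (inj₂ (x , _)) = inj₂ x

yEnds : (G₁ G₂ : Graph) (p₁ : YPort G₁) (p₂ : YPort G₂) →
        OldEv G₁ (YPort.v p₁) ⊎ OldEv G₂ (YPort.v p₂) ⊎ Fin 3 →
        (Fin (V G₁) ⊎ Fin (V G₂)) × (Fin (V G₁) ⊎ Fin (V G₂))
yEnds G₁ G₂ p₁ p₂ (inj₁ (f , _)) = map× inj₁ (ends G₁ f)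
yEnds G₁ G₂ p₁ p₂ (inj₂ (inj₁ (f , _))) = map× inj₂ (ends G₂ f)
yEnds G₁ G₂ p₁ p₂ (inj₂ (inj₂ j)) = inj₁ (YPort.s p₁ j) , inj₂ (YPort.s p₂ j)

-- G is (isomorphic to) G₁ Y G₂ formed at the ports p₁, p₂
record IsY (G₁ G₂ : Graph) (p₁ : YPort G₁) (p₂ : YPort G₂) (G : Graph) : Set where
  field
    vmap : Fin (V G) ↔ (OldV G₁ (YPort.v p₁) ⊎ OldV G₂ (YPort.v p₂))
    emap : Fin (E G) ↔ (OldEv G₁ (YPort.v p₁) ⊎ OldEv G₂ (YPort.v p₂) ⊎ Fin 3)
    ends-ok : ∀ f →
      SameEnds (map× (λ x → forgetY G₁ G₂ (YPort.v p₁) (YPort.v p₂) (Inverse.to vmap x))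
                     (ends G f))
               (yEnds G₁ G₂ p₁ p₂ (Inverse.to emap f))

-- data for the H-operation: an edge d = s₁ s₂ (with its endpoints labelled)
record HPort (G : Graph) : Set where
  field
    d : Fin (E G)
    s₁ s₂ : Fin (V G)
    d-ends : SameEnds (ends G d) (s₁ , s₂)

OldEe : (G : Graph) → Fin (E G) → Set
OldEe G d = Σ (Fin (E G)) λ f → False (f ≟ d)

hEnds : (G₁ G₂ : Graph) (q₁ : HPort G₁) (q₂ : HPort G₂) →
        OldEe G₁ (HPort.d q₁) ⊎ OldEe G₂ (HPort.d q₂) ⊎ Fin 2 →
        (Fin (V G₁) ⊎ Fin (V G₂)) × (Fin (V G₁) ⊎ Fin (V G₂))
hEnds G₁ G₂ q₁ q₂ (inj₁ (f , _)) = map× inj₁ (ends G₁ f)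
hEnds G₁ G₂ q₁ q₂ (inj₂ (inj₁ (f , _))) = map× inj₂ (ends G₂ f)
hEnds G₁ G₂ q₁ q₂ (inj₂ (inj₂ zero)) = inj₁ (HPort.s₁ q₁) , inj₂ (HPort.s₁ q₂)
hEnds G₁ G₂ q₁ q₂ (inj₂ (inj₂ (suc _))) = inj₁ (HPort.s₂ q₁) , inj₂ (HPort.s₂ q₂)

-- G is (isomorphic to) G₁ H G₂ formed at the edges of q₁, q₂
record IsH (G₁ G₂ : Graph) (q₁ : HPort G₁) (q₂ : HPort G₂) (G : Graph) : Set where
  field
    vmap : Fin (V G) ↔ (Fin (V G₁) ⊎ Fin (V G₂))
    emap : Fin (E G) ↔ (OldEe G₁ (HPort.d q₁) ⊎ OldEe G₂ (HPort.d q₂) ⊎ Fin 2)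
    ends-ok : ∀ f → SameEnds (map× (Inverse.to vmap) (ends G f))
                             (hEnds G₁ G₂ q₁ q₂ (Inverse.to emap f))

-- Both compositions cut G along a set of cut edges into a side coming from G₁ and a side coming
-- from G₂, each completed by ports into the whole of G₁ resp. G₂. By the parity lemma the three
-- cut edges of G₁ Y G₂ receive three different colours and the two cut edges of G₁ H G₂ the same
-- colour, so a colouring of G is the gluing of its restrictions to G₁ and G₂, and any two
-- colourings of G₁ and G₂ glue after permuting the colours of the second. The same parity
-- argument shows that any two a/b-coloured cut edges lie on one a/b-chain, hence a Kempe switch
-- of G restricts to at most one switch on each side, while a switch of G₁ lifts to Kempe changes
-- of G that act on G₂ by a global permutation of the colours, itself a Kempe change. Therefore the
-- Kempe class of a colouring of G is determined by the classes of its two restrictions, and every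
-- pair of classes occurs.
module Submission where

open import Defs
open import Data.Nat using (ℕ; _*_)
open import Data.Fin using (Fin)
open import Data.Product using (Σ; _×_; _,_)
open import Data.Sum using (_⊎_; inj₁; inj₂)
open import Function.Bundles using (_↔_; Inverse)
open import Relation.Binary.PropositionalEquality using (_≡_)

module Counting where

  open import Level using (Level)
  open import Data.Nat using (ℕ; zero; suc; _+_; _≤_; _<_; z≤n; s≤s)
  open import Data.Nat.Properties
    using (+-0-commutativeMonoid; +-identityʳ; +-comm; +-assoc; +-mono-≤; +-mono-<-≤; +-mono-≤-<)
  open import Data.Fin using (Fin; zero; suc; _≟_; punchIn)
  open import Data.Fin.Properties using (punchInᵢ≢i)
  open import Data.Bool using (true; false)
  open import Data.Product using (Σ; _×_; _,_; proj₁; proj₂)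
  open import Data.Empty using (⊥-elim)
  open import Function using (_∘_)
  open import Relation.Nullary using (¬_; Dec; yes; no; _because_)
  open import Relation.Nullary.Decidable using (_⊎-dec_; _×-dec_)
  open import Relation.Binary.PropositionalEquality

  open import Algebra.Properties.CommutativeMonoid.Sum +-0-commutativeMonoid public
    using (sum; sum-cong-≗; sum-remove; ∑-distrib-+; ∑-comm)

  private
    variable
      p q : Level
      P : Set p
      Q : Set q

  indicator : Dec P → ℕ
  indicator (true because _) = 1
  indicator (false because _) = 0

  indicator-yes : (P? : Dec P) → P → indicator P? ≡ 1
  indicator-yes (yes _) _ = refl
  indicator-yes (no ¬p) p = ⊥-elim (¬p p)

  indicator-no : (P? : Dec P) → ¬ P → indicator P? ≡ 0
  indicator-no (yes p) ¬p = ⊥-elim (¬p p)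
  indicator-no (no _) _ = refl

  indicator-≤1 : (P? : Dec P) → indicator P? ≤ 1
  indicator-≤1 (yes _) = s≤s z≤n
  indicator-≤1 (no _) = z≤n

  indicator-cong : (P? : Dec P) (Q? : Dec Q) → (P → Q) → (Q → P) → indicator P? ≡ indicator Q?
  indicator-cong (yes p) (yes q) f g = refl
  indicator-cong (yes p) (no ¬q) f g = ⊥-elim (¬q (f p))
  indicator-cong (no ¬p) (yes q) f g = ⊥-elim (¬p (g q))
  indicator-cong (no ¬p) (no ¬q) f g = refl

  indicator-⊎ : (P? : Dec P) (Q? : Dec Q) → ¬ (P × Q) →
                indicator (P? ⊎-dec Q?) ≡ indicator P? + indicator Q?
  indicator-⊎ (yes p) (yes q) disj = ⊥-elim (disj (p , q))
  indicator-⊎ (yes _) (no _) _ = refl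
  indicator-⊎ (no _) (yes _) _ = refl
  indicator-⊎ (no _) (no _) _ = refl

  sum-zero : ∀ {n} {f : Fin n → ℕ} → (∀ i → f i ≡ 0) → sum f ≡ 0
  sum-zero {zero} f≡0 = refl
  sum-zero {suc n} f≡0 rewrite f≡0 zero = sum-zero (f≡0 ∘ suc)

  sum-ones : ∀ {n} {f : Fin n → ℕ} → (∀ i → f i ≡ 1) → sum f ≡ n
  sum-ones {zero} f≡1 = refl
  sum-ones {suc n} f≡1 rewrite f≡1 zero = cong suc (sum-ones (f≡1 ∘ suc))

  sum-mono-≤ : ∀ {n} {f g : Fin n → ℕ} → (∀ i → f i ≤ g i) → sum f ≤ sum g
  sum-mono-≤ {zero} f≤g = z≤n
  sum-mono-≤ {suc n} f≤g = +-mono-≤ (f≤g zero) (sum-mono-≤ (f≤g ∘ suc))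

  sum-mono-< : ∀ {n} {f g : Fin n → ℕ} → (∀ i → f i ≤ g i) → ∀ k → f k < g k → sum f < sum g
  sum-mono-< f≤g zero fk<gk = +-mono-<-≤ fk<gk (sum-mono-≤ (f≤g ∘ suc))
  sum-mono-< f≤g (suc k) fk<gk = +-mono-≤-< (f≤g zero) (sum-mono-< (f≤g ∘ suc) k fk<gk)

  sum-≤1⇒≤n : ∀ {n} {f : Fin n → ℕ} → (∀ i → f i ≤ 1) → sum f ≤ n
  sum-≤1⇒≤n {zero} f≤1 = z≤n
  sum-≤1⇒≤n {suc n} f≤1 = +-mono-≤ (f≤1 zero) (sum-≤1⇒≤n (f≤1 ∘ suc))

  sum-supported-at : ∀ {n} {f : Fin n → ℕ} p → (∀ i → i ≢ p → f i ≡ 0) → sum f ≡ f p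
  sum-supported-at {suc n} {f} p f≡0 = begin
    sum f                       ≡⟨ sum-remove {i = p} f ⟩
    f p + sum (f ∘ punchIn p)   ≡⟨ cong (f p +_) (sum-zero {f = f ∘ punchIn p} (λ i → f≡0 _ (punchInᵢ≢i p i))) ⟩
    f p + 0                     ≡⟨ +-identityʳ (f p) ⟩
    f p                         ∎
    where open ≡-Reasoning

  sum-ones-except : ∀ {n} {f : Fin n → ℕ} p → (∀ i → i ≢ p → f i ≡ 1) → sum f + 1 ≡ f p + n
  sum-ones-except {suc n} {f} p f≡1 = begin
    sum f + 1                        ≡⟨ cong (_+ 1) (sum-remove {i = p} f) ⟩
    f p + sum (f ∘ punchIn p) + 1    ≡⟨ cong (λ s → f p + s + 1) (sum-ones (λ i → f≡1 _ (punchInᵢ≢i p i))) ⟩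
    f p + n + 1                      ≡⟨ +-assoc (f p) n 1 ⟩
    f p + (n + 1)                    ≡⟨ cong (f p +_) (+-comm n 1) ⟩
    f p + suc n                      ∎
    where open ≡-Reasoning

  sum-indicator-≟ : ∀ {n} (p : Fin n) → sum (λ i → indicator (i ≟ p)) ≡ 1
  sum-indicator-≟ p = trans (sum-supported-at p (λ i i≢p → indicator-no (i ≟ p) i≢p))
                            (indicator-yes (p ≟ p) refl)

  sum-indicator-at : ∀ {n} (p : Fin n) {Q : Fin n → Set q} (Q? : ∀ g → Dec (Q g)) →
                     sum (λ g → indicator ((g ≟ p) ×-dec Q? g)) ≡ indicator (Q? p)
  sum-indicator-at p Q? = trans
    (sum-supported-at p (λ g g≢p → indicator-no ((g ≟ p) ×-dec Q? g) (g≢p ∘ proj₁)))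
    (indicator-cong ((p ≟ p) ×-dec Q? p) (Q? p) proj₂ (refl ,_))

  sum-over-image : ∀ {k n} (t : Fin k → Fin n) → (∀ i j → t i ≡ t j → i ≡ j) →
    {P : Fin n → Set p} (P? : ∀ g → Dec (P g)) → (∀ j → P (t j)) → (∀ g → P g → Σ (Fin k) λ j → t j ≡ g) →
    {Q : Fin n → Set q} (Q? : ∀ g → Dec (Q g)) →
    sum (λ g → indicator (P? g ×-dec Q? g)) ≡ sum (λ j → indicator (Q? (t j)))
  sum-over-image {k = k} {n = n} t t-injective P? P-t onto-P Q? = begin
    sum (λ g → indicator (P? g ×-dec Q? g))                 ≡⟨ sum-cong-≗ pointwise ⟩
    sum (λ g → sum (λ j → indicator ((g ≟ t j) ×-dec Q? g))) ≡⟨ ∑-comm (λ (g : Fin n) (j : Fin k) → indicator ((g ≟ t j) ×-dec Q? g)) ⟩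
    sum (λ j → sum (λ g → indicator ((g ≟ t j) ×-dec Q? g))) ≡⟨ sum-cong-≗ (λ j → sum-indicator-at (t j) Q?) ⟩
    sum (λ j → indicator (Q? (t j)))                         ∎
    where
    open ≡-Reasoning
    pointwise : ∀ g → indicator (P? g ×-dec Q? g) ≡ sum (λ j → indicator ((g ≟ t j) ×-dec Q? g))
    pointwise g with P? g
    ... | no ¬pg = sym (sum-zero λ j → indicator-no ((g ≟ t j) ×-dec Q? g) λ { (refl , _) → ¬pg (P-t j) })
    ... | yes pg with onto-P g pg
    ... | j₀ , refl = sym (trans
      (sum-supported-at j₀ λ j j≢j₀ → indicator-no ((t j₀ ≟ t j) ×-dec Q? (t j₀)) (j≢j₀ ∘ sym ∘ t-injective j₀ j ∘ proj₁))
      (indicator-cong ((t j₀ ≟ t j₀) ×-dec Q? (t j₀)) (yes pg ×-dec Q? (t j₀)) (λ (_ , q) → pg , q) (λ (_ , q) → refl , q)))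

module Colours where

  open import Defs using (swapCol; InAB)
  open import Data.Nat using (ℕ)
  open import Data.Fin using (Fin; zero; suc; _≟_)
  open import Data.Fin.Properties using (all?)
  open import Data.List using (List; []; _∷_; _++_)
  open import Data.Product using (Σ; _×_; _,_; proj₁; proj₂)
  open import Data.Sum using (_⊎_; inj₁; inj₂)
  open import Data.Empty using (⊥-elim)
  open import Relation.Nullary using (¬_; Dec; yes; no; ¬?)
  open import Relation.Nullary.Decidable using (_⊎-dec_; _→-dec_; toWitness)
  open import Relation.Binary.PropositionalEquality

  module _ {n : ℕ} where

    swapCol-a : (a b : Fin n) → swapCol a b a ≡ b
    swapCol-a a b with a ≟ a
    ... | yes _ = refl
    ... | no a≢a = ⊥-elim (a≢a refl)

    swapCol-b : (a b : Fin n) → swapCol a b b ≡ a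
    swapCol-b a b with b ≟ a
    ... | yes b≡a = b≡a
    ... | no _ with b ≟ b
    ... | yes _ = refl
    ... | no b≢b = ⊥-elim (b≢b refl)

    swapCol-other : (a b x : Fin n) → ¬ InAB a b x → swapCol a b x ≡ x
    swapCol-other a b x x∉ab with x ≟ a
    ... | yes x≡a = ⊥-elim (x∉ab (inj₁ x≡a))
    ... | no _ with x ≟ b
    ... | yes x≡b = ⊥-elim (x∉ab (inj₂ x≡b))
    ... | no _ = refl

    swapCol-refl : (a x : Fin n) → swapCol a a x ≡ x
    swapCol-refl a x with x ≟ a
    ... | yes x≡a = sym x≡a
    ... | no _ = refl

    InAB? : (a b x : Fin n) → Dec (InAB a b x)
    InAB? a b x = (x ≟ a) ⊎-dec (x ≟ b)

    swapCol-InAB : (a b x : Fin n) → InAB a b x → InAB a b (swapCol a b x)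
    swapCol-InAB a b x (inj₁ refl) rewrite swapCol-a a b = inj₂ refl
    swapCol-InAB a b x (inj₂ refl) rewrite swapCol-b a b = inj₁ refl

    swapCol-InAB⁻ : (a b x : Fin n) → InAB a b (swapCol a b x) → InAB a b x
    swapCol-InAB⁻ a b x x′∈ab with InAB? a b x
    ... | yes x∈ab = x∈ab
    ... | no x∉ab rewrite swapCol-other a b x x∉ab = x′∈ab

    swapCol-involutive : (a b x : Fin n) → swapCol a b (swapCol a b x) ≡ x
    swapCol-involutive a b x with InAB? a b x
    ... | no x∉ab rewrite swapCol-other a b x x∉ab = swapCol-other a b x x∉ab
    ... | yes (inj₁ refl) rewrite swapCol-a a b = swapCol-b a b
    ... | yes (inj₂ refl) rewrite swapCol-b a b = swapCol-a a b

    swapCol-injective : (a b x y : Fin n) → swapCol a b x ≡ swapCol a b y → x ≡ y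
    swapCol-injective a b x y eq = begin
      x                               ≡⟨ swapCol-involutive a b x ⟨
      swapCol a b (swapCol a b x)     ≡⟨ cong (swapCol a b) eq ⟩
      swapCol a b (swapCol a b y)     ≡⟨ swapCol-involutive a b y ⟩
      y                               ∎
      where open ≡-Reasoning

    swapCol-exchanges : (a b u w : Fin n) → InAB a b u → InAB a b w → u ≢ w → swapCol a b u ≡ w
    swapCol-exchanges a b u w (inj₁ refl) (inj₁ refl) u≢w = ⊥-elim (u≢w refl)
    swapCol-exchanges a b u w (inj₁ refl) (inj₂ refl) _ = swapCol-a a b
    swapCol-exchanges a b u w (inj₂ refl) (inj₁ refl) _ = swapCol-b a b
    swapCol-exchanges a b u w (inj₂ refl) (inj₂ refl) u≢w = ⊥-elim (u≢w refl)

    swapCol-moves : (a b u : Fin n) → a ≢ b → InAB a b u → swapCol a b u ≢ u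
    swapCol-moves a b u a≢b (inj₁ refl) eq = a≢b (trans (sym eq) (swapCol-a a b))
    swapCol-moves a b u a≢b (inj₂ refl) eq = a≢b (trans (sym (swapCol-b a b)) eq)

    -- A permutation of the colours, as a product of transpositions (the head acts last).
    Transpositions : Set
    Transpositions = List (Fin n × Fin n)

    permute : Transpositions → Fin n → Fin n
    permute [] x = x
    permute ((a , b) ∷ π) x = swapCol a b (permute π x)

    permute-injective : ∀ π x y → permute π x ≡ permute π y → x ≡ y
    permute-injective [] x y eq = eq
    permute-injective ((a , b) ∷ π) x y eq = permute-injective π x y (swapCol-injective a b _ _ eq)

    permute-++ : ∀ π ρ x → permute (π ++ ρ) x ≡ permute π (permute ρ x)
    permute-++ [] ρ x = refl
    permute-++ ((a , b) ∷ π) ρ x = cong (swapCol a b) (permute-++ π ρ x)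

  remaining-colour : (x y z w : Fin 3) → x ≢ y → x ≢ z → y ≢ z → w ≢ x → w ≢ y → w ≡ z
  remaining-colour = toWitness {a? = all? λ x → all? λ y → all? λ z → all? λ w →
    ¬? (x ≟ y) →-dec ¬? (x ≟ z) →-dec ¬? (y ≟ z) →-dec ¬? (w ≟ x) →-dec ¬? (w ≟ y) →-dec (w ≟ z)} _

  other₁ other₂ : Fin 3 → Fin 3
  other₁ zero = suc zero
  other₁ (suc _) = zero
  other₂ zero = suc (suc zero)
  other₂ (suc zero) = suc (suc zero)
  other₂ (suc (suc zero)) = suc zero

  others-distinct : ∀ x → other₁ x ≢ x × other₂ x ≢ x × other₁ x ≢ other₂ x
  others-distinct zero = (λ ()) , (λ ()) , (λ ())
  others-distinct (suc zero) = (λ ()) , (λ ()) , (λ ())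
  others-distinct (suc (suc zero)) = (λ ()) , (λ ()) , (λ ())

  -- A map Fin 3 → Fin 3 is determined by its three values, so facts about such maps can be
  -- decided by running through the value triples.
  triple : Fin 3 → Fin 3 → Fin 3 → Fin 3 → Fin 3
  triple a₀ a₁ a₂ zero = a₀
  triple a₀ a₁ a₂ (suc zero) = a₁
  triple a₀ a₁ a₂ (suc (suc zero)) = a₂

  triple-η : (a : Fin 3 → Fin 3) → ∀ j → a j ≡ triple (a zero) (a (suc zero)) (a (suc (suc zero))) j
  triple-η a zero = refl
  triple-η a (suc zero) = refl
  triple-η a (suc (suc zero)) = refl

  AllDifferent : (Fin 3 → Fin 3) → Set
  AllDifferent a = ∀ j k → j ≢ k → a j ≢ a k

  allDifferent? : ∀ a₀ a₁ a₂ → Dec (AllDifferent (triple a₀ a₁ a₂))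
  allDifferent? a₀ a₁ a₂ = all? λ j → all? λ k → ¬? (j ≟ k) →-dec ¬? (triple a₀ a₁ a₂ j ≟ triple a₀ a₁ a₂ k)

  module _ (a : Fin 3 → Fin 3) where

    AllDifferent-triple : AllDifferent a → AllDifferent (triple (a zero) (a (suc zero)) (a (suc (suc zero))))
    AllDifferent-triple diff j k j≢k eq = diff j k j≢k (trans (triple-η a j) (trans eq (sym (triple-η a k))))

    AllDifferent-triple⁻ : AllDifferent (triple (a zero) (a (suc zero)) (a (suc (suc zero)))) → AllDifferent a
    AllDifferent-triple⁻ diff j k j≢k eq = diff j k j≢k (trans (sym (triple-η a j)) (trans eq (triple-η a k)))

  colour-trichotomy : ∀ x w → w ≡ x ⊎ w ≡ other₁ x ⊎ w ≡ other₂ x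
  colour-trichotomy = toWitness {a? = all? λ x → all? λ w →
    (w ≟ x) ⊎-dec (w ≟ other₁ x) ⊎-dec (w ≟ other₂ x)} _

  agree-on-three : ∀ x {f g : Fin 3 → Fin 3} → f x ≡ g x → f (other₁ x) ≡ g (other₁ x) → f (other₂ x) ≡ g (other₂ x) →
                   ∀ w → f w ≡ g w
  agree-on-three x fx f₁ f₂ w with colour-trichotomy x w
  ... | inj₁ refl = fx
  ... | inj₂ (inj₁ refl) = f₁
  ... | inj₂ (inj₂ refl) = f₂

  module _ (π : Fin 3 → Fin 3) (π-injective : ∀ u v → π u ≡ π v → u ≡ v) (x : Fin 3) (πx≡x : π x ≡ x) where

    private
      o₁ o₂ : Fin 3
      o₁ = other₁ x
      o₂ = other₂ x

      o₁≢o₂ : o₁ ≢ o₂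
      o₁≢o₂ = proj₂ (proj₂ (others-distinct x))

      stays-off : ∀ w → w ≢ x → π w ≡ o₁ ⊎ π w ≡ o₂
      stays-off w w≢x with colour-trichotomy x (π w)
      ... | inj₁ πw≡x = ⊥-elim (w≢x (π-injective w x (trans πw≡x (sym πx≡x))))
      ... | inj₂ πw≡o = πw≡o

    fixing-permutation : (∀ w → π w ≡ w) ⊎ (∀ w → π w ≡ swapCol (other₁ x) (other₂ x) w)
    fixing-permutation with stays-off o₁ (proj₁ (others-distinct x)) | stays-off o₂ (proj₁ (proj₂ (others-distinct x)))
    ... | inj₁ πo₁≡o₁ | inj₂ πo₂≡o₂ = inj₁ (agree-on-three x πx≡x πo₁≡o₁ πo₂≡o₂)
    ... | inj₂ πo₁≡o₂ | inj₁ πo₂≡o₁ = inj₂ (agree-on-three x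
            (trans πx≡x (sym (swapCol-other o₁ o₂ x λ
              { (inj₁ x≡o₁) → proj₁ (others-distinct x) (sym x≡o₁)
              ; (inj₂ x≡o₂) → proj₁ (proj₂ (others-distinct x)) (sym x≡o₂) })))
            (trans πo₁≡o₂ (sym (swapCol-a o₁ o₂))) (trans πo₂≡o₁ (sym (swapCol-b o₁ o₂))))
    ... | inj₁ πo₁≡o₁ | inj₁ πo₂≡o₁ = ⊥-elim (o₁≢o₂ (π-injective o₁ o₂ (trans πo₁≡o₁ (sym πo₂≡o₁))))
    ... | inj₂ πo₁≡o₂ | inj₂ πo₂≡o₂ = ⊥-elim (o₁≢o₂ (π-injective o₁ o₂ (trans πo₁≡o₂ (sym πo₂≡o₂))))

  transpositions-between : (a a′ : Fin 3 → Fin 3) → AllDifferent a → AllDifferent a′ →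
                           Σ Transpositions λ π → ∀ j → permute π (a′ j) ≡ a j
  transpositions-between a a′ diff diff′ = π , maps
    where
    0′ 1′ 2′ : Fin 3
    0′ = zero
    1′ = suc zero
    2′ = suc (suc zero)
    π₁ : Transpositions
    π₁ = (a′ 0′ , a 0′) ∷ []
    b : Fin 3
    b = permute π₁ (a′ 1′)
    π : Transpositions
    π = (b , a 1′) ∷ π₁
    maps₀ : permute π (a′ 0′) ≡ a 0′
    maps₀ = trans (cong (swapCol b (a 1′)) (swapCol-a (a′ 0′) (a 0′))) (swapCol-other b (a 1′) (a 0′) λ
      { (inj₁ a₀≡b) → diff′ 0′ 1′ (λ ()) (permute-injective π₁ _ _ (trans (swapCol-a (a′ 0′) (a 0′)) a₀≡b))
      ; (inj₂ a₀≡a₁) → diff 0′ 1′ (λ ()) a₀≡a₁ })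
    maps₁ : permute π (a′ 1′) ≡ a 1′
    maps₁ = swapCol-a b (a 1′)
    maps : ∀ j → permute π (a′ j) ≡ a j
    maps zero = maps₀
    maps (suc zero) = maps₁
    maps (suc (suc zero)) = remaining-colour (a 0′) (a 1′) (a 2′) _ (diff 0′ 1′ (λ ())) (diff 0′ 2′ (λ ())) (diff 1′ 2′ (λ ()))
      (λ e → diff′ 2′ 0′ (λ ()) (permute-injective π _ _ (trans e (sym maps₀))))
      (λ e → diff′ 2′ 1′ (λ ()) (permute-injective π _ _ (trans e (sym maps₁))))

module Chains where

  open Counting
  open Colours
  open import Data.Nat using (ℕ; zero; suc; _≤_; _<_; z≤n; s≤s)
  open import Data.Nat.Properties using (≤-trans; <-≤-trans; ≤-refl; <⇒≢)
  open import Data.Fin using (Fin; _≟_)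
  open import Data.Fin.Properties using (any?; all?; ¬∀⟶∃¬)
  open import Data.Vec using (Vec; lookup; tabulate)
  open import Data.Vec.Properties using (lookup∘tabulate; tabulate∘lookup; tabulate-cong)
  open import Data.Product using (∃; _×_; _,_; proj₂)
  open import Data.Sum using (_⊎_; inj₁; inj₂)
  open import Data.Bool using (if_then_else_)
  open import Data.Empty using (⊥-elim)
  open import Relation.Nullary using (¬_; Dec; yes; no; does)
  open import Relation.Nullary.Decidable using (_×-dec_; _⊎-dec_; _→-dec_)
  open import Relation.Binary.PropositionalEquality

  lookup-ext : ∀ {A : Set} {m} (u w : Vec A m) → (∀ i → lookup u i ≡ lookup w i) → u ≡ w
  lookup-ext u w eq = trans (sym (tabulate∘lookup u)) (trans (tabulate-cong eq) (tabulate∘lookup w))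

  ShareEnd-sym : (G : Graph) {f g : Fin (E G)} → ShareEnd G f g → ShareEnd G g f
  ShareEnd-sym G (v , p , q) = v , q , p

  ShareEnd? : (G : Graph) (f g : Fin (E G)) → Dec (ShareEnd G f g)
  ShareEnd? G f g = any? (λ v → inc? G v f ×-dec inc? G v g)

  module _ (G : Graph) {n : ℕ} where
    private
      Col : Set
      Col = Colouring G n

    recolourWhere : (c : Col) {U : Fin (E G) → Set} → (∀ g → Dec (U g)) → (Fin n → Fin n) → Col
    recolourWhere c U? t = tabulate (λ g → if does (U? g) then t (lookup c g) else lookup c g)

    module _ (c : Col) {U : Fin (E G) → Set} (U? : ∀ g → Dec (U g)) (t : Fin n → Fin n) where

      recolourWhere-in : ∀ g → U g → lookup (recolourWhere c U? t) g ≡ t (lookup c g)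
      recolourWhere-in g u rewrite lookup∘tabulate (λ g → if does (U? g) then t (lookup c g) else lookup c g) g
        with U? g
      ... | yes _ = refl
      ... | no ¬u = ⊥-elim (¬u u)

      recolourWhere-out : ∀ g → ¬ U g → lookup (recolourWhere c U? t) g ≡ lookup c g
      recolourWhere-out g ¬u rewrite lookup∘tabulate (λ g → if does (U? g) then t (lookup c g) else lookup c g) g
        with U? g
      ... | yes u = ⊥-elim (¬u u)
      ... | no _ = refl

    module _ {c : Col} {a b : Fin n} where

      Reach-InAB : ∀ {f g} → InAB a b (lookup c f) → Reach G c a b f g → InAB a b (lookup c g)
      Reach-InAB f∈ab here = f∈ab
      Reach-InAB f∈ab (step _ _ g∈ab) = g∈ab

      Reach-trans : ∀ {f g h} → Reach G c a b f g → Reach G c a b g h → Reach G c a b f h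
      Reach-trans r here = r
      Reach-trans r (step r′ s q) = step (Reach-trans r r′) s q

      Reach-sym : ∀ {f g} → InAB a b (lookup c f) → Reach G c a b f g → Reach G c a b g f
      Reach-sym f∈ab here = here
      Reach-sym f∈ab (step r s q) =
        Reach-trans (step here (ShareEnd-sym G s) (Reach-InAB f∈ab r)) (Reach-sym f∈ab r)

    Reach-transport : ∀ {c c′ : Col} {a b f g} →
                      (∀ h → InAB a b (lookup c h) → InAB a b (lookup c′ h)) →
                      Reach G c a b f g → Reach G c′ a b f g
    Reach-transport t here = here
    Reach-transport t (step r s q) = step (Reach-transport t r) s (t _ q)

    -- Chains are decided by iterating "add the neighbours in the chain" until nothing new appears;
    -- as long as it is not stable the set grows, so it stabilises within |E| rounds.
    module Bounded (c : Col) (a b : Fin n) (f : Fin (E G)) where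

      Within : ℕ → Fin (E G) → Set
      Within zero g = g ≡ f
      Within (suc k) g = Within k g ⊎ (∃ λ h → Within k h × ShareEnd G h g × InAB a b (lookup c g))

      within? : ∀ k g → Dec (Within k g)
      within? zero g = g ≟ f
      within? (suc k) g =
        within? k g ⊎-dec any? (λ h → within? k h ×-dec (ShareEnd? G h g ×-dec InAB? a b (lookup c g)))

      within⇒Reach : ∀ k g → Within k g → Reach G c a b f g
      within⇒Reach zero g refl = here
      within⇒Reach (suc k) g (inj₁ w) = within⇒Reach k g w
      within⇒Reach (suc k) g (inj₂ (h , w , s , q)) = step (within⇒Reach k h w) s q

      Reach⇒within : ∀ g → Reach G c a b f g → ∃ λ k → Within k g
      Reach⇒within g here = 0 , refl
      Reach⇒within g (step {h} r s q) with Reach⇒within h r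
      ... | k , w = suc k , inj₂ (h , w , s , q)

      Stable : ℕ → Set
      Stable k = ∀ g → Within (suc k) g → Within k g

      stable-within : ∀ j → Stable j → ∀ k g → Within k g → Within j g
      stable-within j st zero g refl = base j
        where
        base : ∀ j → Within j f
        base zero = refl
        base (suc j) = inj₁ (base j)
      stable-within j st (suc k) g (inj₁ w) = stable-within j st k g w
      stable-within j st (suc k) g (inj₂ (h , w , s , q)) = st g (inj₂ (h , stable-within j st k h w , s , q))

      size : ℕ → ℕ
      size k = sum (λ g → indicator (within? k g))

      stable-or-large : ∀ k → (∃ λ j → Stable j) ⊎ (suc k ≤ size k)
      stable-or-large zero = inj₂ (≤-reflexive (sym (sum-indicator-≟ f)))
        where open import Data.Nat.Properties using (≤-reflexive)
      stable-or-large (suc k) with stable-or-large k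
      ... | inj₁ st = inj₁ st
      ... | inj₂ large with all? (λ g → within? (suc k) g →-dec within? k g)
      ... | yes st = inj₁ (k , st)
      ... | no ¬st with ¬∀⟶∃¬ (E G) _ (λ g → within? (suc k) g →-dec within? k g) ¬st
      ... | g , new = inj₂ (≤-trans (s≤s large) (sum-mono-< grows g strictly))
        where
        grows : ∀ h → indicator (within? k h) ≤ indicator (within? (suc k) h)
        grows h with within? k h | within? (suc k) h
        ... | yes _ | yes _ = ≤-refl
        ... | yes w | no ¬w = ⊥-elim (¬w (inj₁ w))
        ... | no _ | _ = z≤n
        strictly : indicator (within? k g) < indicator (within? (suc k) g)
        strictly with within? k g | within? (suc k) g
        ... | yes w | _ = ⊥-elim (new (λ _ → w))
        ... | no _ | yes _ = s≤s z≤n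
        ... | no _ | no ¬w = ⊥-elim (new (λ w → ⊥-elim (¬w w)))

      stabilises : ∃ λ j → Stable j
      stabilises with stable-or-large (E G)
      ... | inj₁ st = st
      ... | inj₂ large =
        ⊥-elim (<⇒≢ (<-≤-trans large (sum-≤1⇒≤n (λ g → indicator-≤1 (within? (E G) g)))) refl)

      decide : ∀ g → Dec (Reach G c a b f g)
      decide g with stabilises
      ... | j , st with within? j g
      ... | yes w = yes (within⇒Reach j g w)
      ... | no ¬w = no λ r → ¬w (stable-within j st _ g (proj₂ (Reach⇒within g r)))

    Reach? : (c : Col) (a b : Fin n) (f g : Fin (E G)) → Dec (Reach G c a b f g)
    Reach? c a b f = Bounded.decide c a b f

module Switches where

  open Colours
  open Chains
  open import Data.Nat using (ℕ)
  open import Data.Fin using (Fin)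
  open import Data.Vec using (lookup; tabulate)
  open import Data.Vec.Properties using (lookup∘tabulate)
  open import Data.List using (List; []; _∷_; _++_; allFin)
  open import Data.List.Relation.Unary.Any as Any using (Any; here; there)
  open import Data.List.Membership.Propositional.Properties using (∈-allFin)
  open import Data.Product using (Σ; _×_; _,_; proj₁; proj₂)
  open import Data.Unit using (⊤; tt)
  open import Data.Empty using (⊥-elim)
  open import Function using (_∘_; id)
  open import Relation.Nullary using (¬_; Dec; yes; no)
  open import Relation.Nullary.Decidable using (_×-dec_)
  open import Relation.Binary.PropositionalEquality
  open import Relation.Binary.Construct.Closure.ReflexiveTransitive using (Star; ε; _◅_; _◅◅_; gmap; reverse)

  module _ (G : Graph) {n : ℕ} where
    private
      Col : Set
      Col = Colouring G n

    SwitchAt : Col → Col → Fin n → Fin n → Fin (E G) → Set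
    SwitchAt c c′ a b f = InAB a b (lookup c f) ×
      (∀ g → (Reach G c a b f g → lookup c′ g ≡ swapCol a b (lookup c g)) ×
             (¬ Reach G c a b f g → lookup c′ g ≡ lookup c g))

    switchAt : (c : Col) (a b : Fin n) (f : Fin (E G)) → Col
    switchAt c a b f = recolourWhere G c (Reach? G c a b f) (swapCol a b)

    switchAt-SwitchAt : (c : Col) (a b : Fin n) (f : Fin (E G)) → InAB a b (lookup c f) →
                        SwitchAt c (switchAt c a b f) a b f
    switchAt-SwitchAt c a b f f∈ab = f∈ab , λ g →
      recolourWhere-in G c (Reach? G c a b f) (swapCol a b) g ,
      recolourWhere-out G c (Reach? G c a b f) (swapCol a b) g

    module _ {c c′ : Col} {a b : Fin n} {f : Fin (E G)} (sw : SwitchAt c c′ a b f) where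

      SwitchAt-InAB : ∀ g → InAB a b (lookup c g) → InAB a b (lookup c′ g)
      SwitchAt-InAB g q with Reach? G c a b f g
      ... | yes r rewrite proj₁ (proj₂ sw g) r = swapCol-InAB a b _ q
      ... | no ¬r rewrite proj₂ (proj₂ sw g) ¬r = q

      SwitchAt-InAB⁻ : ∀ g → InAB a b (lookup c′ g) → InAB a b (lookup c g)
      SwitchAt-InAB⁻ g q with Reach? G c a b f g
      ... | yes r rewrite proj₁ (proj₂ sw g) r = swapCol-InAB⁻ a b _ q
      ... | no ¬r rewrite proj₂ (proj₂ sw g) ¬r = q

      SwitchAt-Reach : ∀ {g h} → Reach G c a b g h → Reach G c′ a b g h
      SwitchAt-Reach = Reach-transport G SwitchAt-InAB

      SwitchAt-Reach⁻ : ∀ {g h} → Reach G c′ a b g h → Reach G c a b g h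
      SwitchAt-Reach⁻ = Reach-transport G SwitchAt-InAB⁻

      SwitchAt-sym : SwitchAt c′ c a b f
      SwitchAt-sym = SwitchAt-InAB f (proj₁ sw) , λ g →
        (λ r → trans (sym (swapCol-involutive a b _)) (cong (swapCol a b) (sym (proj₁ (proj₂ sw g) (SwitchAt-Reach⁻ r))))) ,
        (λ ¬r → sym (proj₂ (proj₂ sw g) (¬r ∘ SwitchAt-Reach)))

    KempeSwitch-sym : ∀ {c c′ : Col} → KempeSwitch G c c′ → KempeSwitch G c′ c
    KempeSwitch-sym (a , b , f , sw) = a , b , f , SwitchAt-sym sw

    KempeEquiv-sym : ∀ {c c′ : Col} → KempeEquiv G c c′ → KempeEquiv G c′ c
    KempeEquiv-sym = reverse KempeSwitch-sym

    -- The recoloured chain is a whole component, so no edge inside it meets an edge outside of the same colour.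
    KempeSwitch-Proper : ∀ {c c′ : Col} → Proper G c → KempeSwitch G c c′ → Proper G c′
    KempeSwitch-Proper {c} pc (a , b , f , f∈ab , sw) g h g≢h s with Reach? G c a b f g | Reach? G c a b f h
    ... | yes rg | yes rh rewrite proj₁ (sw g) rg | proj₁ (sw h) rh =
          pc g h g≢h s ∘ swapCol-injective a b _ _
    ... | no ¬rg | no ¬rh rewrite proj₂ (sw g) ¬rg | proj₂ (sw h) ¬rh = pc g h g≢h s
    ... | yes rg | no ¬rh rewrite proj₁ (sw g) rg | proj₂ (sw h) ¬rh = λ eq →
          ¬rh (step rg s (subst (InAB a b) eq (swapCol-InAB a b _ (Reach-InAB G f∈ab rg))))
    ... | no ¬rg | yes rh rewrite proj₂ (sw g) ¬rg | proj₁ (sw h) rh = λ eq →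
          ¬rg (step rh (ShareEnd-sym G s) (subst (InAB a b) (sym eq) (swapCol-InAB a b _ (Reach-InAB G f∈ab rh))))

    KempeEquiv-Proper : ∀ {c c′ : Col} → Proper G c → KempeEquiv G c c′ → Proper G c′
    KempeEquiv-Proper pc ε = pc
    KempeEquiv-Proper pc (_◅_ {j = d} s ss) = KempeEquiv-Proper (KempeSwitch-Proper {c′ = d} pc s) ss

    SwitchIn : Fin n → Fin n → (Fin (E G) → Set) → Col → Col → Set
    SwitchIn a b U d d′ = Σ (Fin (E G)) λ f → U f × (∀ g → Reach G d a b f g → U g) × SwitchAt d d′ a b f

    SwitchIn⇒KempeSwitch : ∀ {a b U} {d d′ : Col} → SwitchIn a b U d d′ → KempeSwitch G d d′
    SwitchIn⇒KempeSwitch {a} {b} (f , _ , _ , sw) = a , b , f , sw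

    -- Exchanging a and b on a union U of a/b-chains is a sequence of switches on chains inside U:
    -- switch, one after the other, the chains of the edges not yet handled.
    module SwitchUnion (c : Col) (a b : Fin n) {U : Fin (E G) → Set} (U? : ∀ g → Dec (U g))
                       (closed : ∀ g h → U g → InAB a b (lookup c g) → Reach G c a b g h → U h) where

      Handled : List (Fin (E G)) → Fin (E G) → Set
      Handled L g = Any (λ i → U i × InAB a b (lookup c i) × Reach G c a b i g) L

      handled? : ∀ L g → Dec (Handled L g)
      handled? L g = Any.any? (λ i → U? i ×-dec (InAB? a b (lookup c i) ×-dec Reach? G c a b i g)) L

      after : List (Fin (E G)) → Col
      after L = recolourWhere G c (handled? L) (swapCol a b)

      after-in : ∀ L g → Handled L g → lookup (after L) g ≡ swapCol a b (lookup c g)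
      after-in L = recolourWhere-in G c (handled? L) (swapCol a b)

      after-out : ∀ L g → ¬ Handled L g → lookup (after L) g ≡ lookup c g
      after-out L = recolourWhere-out G c (handled? L) (swapCol a b)

      after-InAB⁻ : ∀ L h → InAB a b (lookup (after L) h) → InAB a b (lookup c h)
      after-InAB⁻ L h q with handled? L h
      ... | yes hd rewrite after-in L h hd = swapCol-InAB⁻ a b _ q
      ... | no ¬hd rewrite after-out L h ¬hd = q

      after-InAB : ∀ L h → InAB a b (lookup c h) → InAB a b (lookup (after L) h)
      after-InAB L h q with handled? L h
      ... | yes hd rewrite after-in L h hd = swapCol-InAB a b _ q
      ... | no ¬hd rewrite after-out L h ¬hd = q

      after-cong : ∀ L L′ → (∀ g → Handled L g → Handled L′ g) → (∀ g → Handled L′ g → Handled L g) →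
                   after L ≡ after L′
      after-cong L L′ to from = lookup-ext _ _ λ g → eq g (handled? L g)
        where
        eq : ∀ g → Dec (Handled L g) → lookup (after L) g ≡ lookup (after L′) g
        eq g (yes hd) = trans (after-in L g hd) (sym (after-in L′ g (to g hd)))
        eq g (no ¬hd) = trans (after-out L g ¬hd) (sym (after-out L′ g (¬hd ∘ from g)))

      new-chain : ∀ i L → U i → InAB a b (lookup c i) → ¬ Handled L i → SwitchIn a b U (after L) (after (i ∷ L))
      new-chain i L ui qi ¬hi = i , ui , (λ g r → closed i g ui qi (back r)) ,
        subst (InAB a b) (sym (after-out L i ¬hi)) qi , λ g → inside g , outside g
        where
        back : ∀ {g} → Reach G (after L) a b i g → Reach G c a b i g
        back = Reach-transport G (after-InAB⁻ L)
        inside : ∀ g → Reach G (after L) a b i g → lookup (after (i ∷ L)) g ≡ swapCol a b (lookup (after L) g)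
        inside g r = trans (after-in (i ∷ L) g (here (ui , qi , back r)))
          (cong (swapCol a b) (sym (after-out L g λ hg → ¬hi (Any.map
            (λ { (uj , qj , rj) → uj , qj , Reach-trans G rj (Reach-sym G qi (back r)) }) hg))))
        outside : ∀ g → ¬ Reach G (after L) a b i g → lookup (after (i ∷ L)) g ≡ lookup (after L) g
        outside g ¬r with handled? L g
        ... | yes hg = trans (after-in (i ∷ L) g (there hg)) (sym (after-in L g hg))
        ... | no ¬hg = trans (after-out (i ∷ L) g λ
                        { (here (_ , _ , r)) → ¬r (Reach-transport G (after-InAB L) r)
                        ; (there hg) → ¬hg hg })
                        (sym (after-out L g ¬hg))

      run : ∀ L → Star (SwitchIn a b U) c (after L)
      run [] = subst (Star (SwitchIn a b U) c) (lookup-ext _ _ λ g → sym (after-out [] g λ ())) ε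
      run (i ∷ L) with U? i ×-dec InAB? a b (lookup c i) | handled? L i
      ... | yes (ui , qi) | no ¬hi = run L ◅◅ (new-chain i L ui qi ¬hi ◅ ε)
      ... | yes (ui , qi) | yes hi = subst (Star (SwitchIn a b U) c) (after-cong L (i ∷ L) (λ _ → there) from) (run L)
        where
        from : ∀ g → Handled (i ∷ L) g → Handled L g
        from g (here (_ , _ , r)) = Any.map (λ { (uj , qj , rj) → uj , qj , Reach-trans G rj r }) hi
        from g (there hg) = hg
      ... | no ¬iq | _ = subst (Star (SwitchIn a b U) c) (after-cong L (i ∷ L) (λ _ → there) from) (run L)
        where
        from : ∀ g → Handled (i ∷ L) g → Handled L g
        from g (here (ui , qi , _)) = ⊥-elim (¬iq (ui , qi))
        from g (there hg) = hg

      target : Col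
      target = recolourWhere G c U? (swapCol a b)

      result : Star (SwitchIn a b U) c target
      result = subst (Star (SwitchIn a b U) c) (lookup-ext _ _ λ g → eq g (handled? (allFin (E G)) g) (U? g))
                     (run (allFin (E G)))
        where
        unhandle : ∀ {L g} → Handled L g → U g
        unhandle (here (ui , qi , r)) = closed _ _ ui qi r
        unhandle (there hg) = unhandle hg
        eq : ∀ g → Dec (Handled (allFin (E G)) g) → Dec (U g) → lookup (after (allFin (E G))) g ≡ lookup target g
        eq g (yes hg) (yes u) = trans (after-in _ g hg) (sym (recolourWhere-in G c U? (swapCol a b) g u))
        eq g (yes hg) (no ¬u) = ⊥-elim (¬u (unhandle hg))
        eq g (no ¬hg) (yes u) = trans (after-out _ g ¬hg)
          (sym (trans (recolourWhere-in G c U? (swapCol a b) g u) (swapCol-other a b _ λ q →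
            ¬hg (Any.map (λ { refl → u , q , here }) (∈-allFin g)))))
        eq g (no ¬hg) (no ¬u) = trans (after-out _ g ¬hg) (sym (recolourWhere-out G c U? (swapCol a b) g ¬u))

    KempeEquiv-swapCol : (c : Col) (a b : Fin n) → KempeEquiv G c (tabulate (swapCol a b ∘ lookup c))
    KempeEquiv-swapCol c a b = subst (KempeEquiv G c) (lookup-ext _ _ eq) (gmap id (λ {d} {d′} → SwitchIn⇒KempeSwitch {d = d} {d′}) All.result)
      where
      module All = SwitchUnion c a b {U = λ _ → ⊤} (λ _ → yes tt) (λ _ _ _ _ _ → tt)
      eq : ∀ g → lookup All.target g ≡ lookup (tabulate (swapCol a b ∘ lookup c)) g
      eq g = trans (recolourWhere-in G c (λ _ → yes tt) (swapCol a b) g tt)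
                   (sym (lookup∘tabulate (swapCol a b ∘ lookup c) g))

    permuteColouring : Transpositions → Col → Col
    permuteColouring π c = tabulate (permute π ∘ lookup c)

    lookup-permuteColouring : ∀ π c g → lookup (permuteColouring π c) g ≡ permute π (lookup c g)
    lookup-permuteColouring π c = lookup∘tabulate (permute π ∘ lookup c)

    permuteColouring-[] : ∀ c → permuteColouring [] c ≡ c
    permuteColouring-[] c = lookup-ext _ _ (lookup-permuteColouring [] c)

    permuteColouring-++ : ∀ π ρ c → permuteColouring π (permuteColouring ρ c) ≡ permuteColouring (π ++ ρ) c
    permuteColouring-++ π ρ c = lookup-ext _ _ λ g → begin
      lookup (permuteColouring π (permuteColouring ρ c)) g ≡⟨ lookup-permuteColouring π (permuteColouring ρ c) g ⟩
      permute π (lookup (permuteColouring ρ c) g)          ≡⟨ cong (permute π) (lookup-permuteColouring ρ c g) ⟩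
      permute π (permute ρ (lookup c g))                   ≡⟨ permute-++ π ρ _ ⟨
      permute (π ++ ρ) (lookup c g)                        ≡⟨ lookup-permuteColouring (π ++ ρ) c g ⟨
      lookup (permuteColouring (π ++ ρ) c) g               ∎
      where open ≡-Reasoning

    permuteColouring-Proper : ∀ π c → Proper G c → Proper G (permuteColouring π c)
    permuteColouring-Proper π c pc f g f≢g s eq = pc f g f≢g s (permute-injective π _ _
      (trans (sym (lookup-permuteColouring π c f)) (trans eq (lookup-permuteColouring π c g))))

    KempeEquiv-permuteColouring : ∀ π c → KempeEquiv G c (permuteColouring π c)
    KempeEquiv-permuteColouring [] c = subst (KempeEquiv G c) (sym (permuteColouring-[] c)) ε
    KempeEquiv-permuteColouring ((a , b) ∷ π) c =
      KempeEquiv-permuteColouring π c ◅◅ subst (KempeEquiv G _) swapped (KempeEquiv-swapCol _ a b)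
      where
      swapped : tabulate (swapCol a b ∘ lookup (permuteColouring π c)) ≡ permuteColouring ((a , b) ∷ π) c
      swapped = lookup-ext _ _ λ g → trans (lookup∘tabulate (swapCol a b ∘ lookup (permuteColouring π c)) g)
        (trans (cong (swapCol a b) (lookup-permuteColouring π c g)) (sym (lookup-permuteColouring ((a , b) ∷ π) c g)))

    SwitchAt-unique : ∀ {c w w′ : Col} {a b f} → SwitchAt c w a b f → SwitchAt c w′ a b f → w ≡ w′
    SwitchAt-unique {c} {w} {w′} {a} {b} {f} (_ , sw) (_ , sw′) = lookup-ext _ _ λ g → eq g (Reach? G c a b f g)
      where
      eq : ∀ g → Dec (Reach G c a b f g) → lookup w g ≡ lookup w′ g
      eq g (yes r) = trans (proj₁ (sw g) r) (sym (proj₁ (sw′ g) r))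
      eq g (no ¬r) = trans (proj₂ (sw g) ¬r) (sym (proj₂ (sw′ g) ¬r))

    SwitchAt-refl : ∀ {c w : Col} {a f} → SwitchAt c w a a f → w ≡ c
    SwitchAt-refl {c} {w} {a} {f} (_ , sw) = lookup-ext _ _ λ g → eq g (Reach? G c a a f g)
      where
      eq : ∀ g → Dec (Reach G c a a f g) → lookup w g ≡ lookup c g
      eq g (yes r) = trans (proj₁ (sw g) r) (swapCol-refl a _)
      eq g (no ¬r) = proj₂ (sw g) ¬r

module CutSides where

  open Colours
  open Chains
  open Switches
  open import Data.Fin using (Fin; _≟_)
  open import Data.Fin.Properties using (any?)
  open import Data.Vec using (lookup; tabulate)
  open import Data.Vec.Properties using (lookup∘tabulate)
  open import Data.Product using (Σ; _×_; _,_; proj₁; proj₂)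
  open import Data.Empty using (⊥-elim)
  open import Function using (_∘_)
  open import Relation.Nullary using (¬_; Dec; yes; no)
  open import Relation.Nullary.Decidable using (_×-dec_)
  open import Relation.Binary.PropositionalEquality
  open import Relation.Binary.Construct.Closure.ReflexiveTransitive using (ε; _◅_; _◅◅_)

  Col₃ : Graph → Set
  Col₃ G = Colouring G 3

  -- G₁ is one side of an edge cut of G, completed by ports: the edges of G₁ that
  -- are not ports are the inner edges of G, the ports stand for the cut edges.
  record CutSide (G G₁ : Graph) : Set₁ where
    field
      ι : Fin (E G₁) → Fin (E G)
      Port : Fin (E G₁) → Set
      Port? : ∀ g → Dec (Port g)
      Inner : Fin (E G) → Set
      Inner? : ∀ y → Dec (Inner y)
      Cut : Fin (E G) → Set
      Cut? : ∀ y → Dec (Cut y)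
      cutPort : Fin (E G) → Fin (E G₁)
      ι-Inner : ∀ g → ¬ Port g → Inner (ι g)
      ι-Cut : ∀ p → Port p → Cut (ι p)
      Inner-ι⁻ : ∀ y → Inner y → Σ (Fin (E G₁)) λ g → ¬ Port g × ι g ≡ y
      ι-injective : ∀ g h → ¬ Port g → ¬ Port h → ι g ≡ ι h → g ≡ h
      Cut⇒¬Inner : ∀ y → Cut y → ¬ Inner y
      cutPort-Port : ∀ y → Cut y → Port (cutPort y)
      cutPort-ι : ∀ p → Port p → cutPort (ι p) ≡ p
      ShareEnd-ι⁻ : ∀ g h → ¬ Port g → ¬ Port h → ShareEnd G (ι g) (ι h) → ShareEnd G₁ g h
      ShareEnd-ι : ∀ g h → ¬ Port g → ¬ Port h → ShareEnd G₁ g h → ShareEnd G (ι g) (ι h)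
      ShareEnd-port : ∀ g p → ¬ Port g → Port p → ShareEnd G₁ g p →
                      Σ (Fin (E G)) λ y → Cut y × cutPort y ≡ p × ShareEnd G (ι g) y
      ShareEnd-cut : ∀ g y → ¬ Port g → Cut y → ShareEnd G (ι g) y → ShareEnd G₁ g (cutPort y)
      ports-ShareEnd : ∀ p q → Port p → Port q → ShareEnd G₁ p q
      outer-¬ShareEnd-inner : ∀ y z → ¬ Inner y → ¬ Cut y → Inner z → ¬ ShareEnd G y z
      cut-colour : ∀ (c : Col₃ G) → Proper G c → ∀ y → Cut y → lookup c y ≡ lookup c (ι (cutPort y))
      ports-coloured-apart : ∀ (c : Col₃ G) → Proper G c → ∀ p q → Port p → Port q → p ≢ q →
                             lookup c (ι p) ≢ lookup c (ι q)
      cuts-linked : ∀ (c : Col₃ G) → Proper G c → ∀ a b → a ≢ b → ∀ x y → Cut x → Cut y →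
                    InAB a b (lookup c x) → InAB a b (lookup c y) → Reach G c a b x y

  module Restriction {G G₁ : Graph} (S : CutSide G G₁) where
    open CutSide S

    restrict : Col₃ G → Col₃ G₁
    restrict c = tabulate (lookup c ∘ ι)

    lookup-restrict : ∀ c g → lookup (restrict c) g ≡ lookup c (ι g)
    lookup-restrict c = lookup∘tabulate (lookup c ∘ ι)

    restrict-Proper : ∀ c → Proper G c → Proper G₁ (restrict c)
    restrict-Proper c pc g h g≢h s rewrite lookup-restrict c g | lookup-restrict c h with Port? g | Port? h
    ... | no ¬pg | no ¬ph = pc (ι g) (ι h) (g≢h ∘ ι-injective g h ¬pg ¬ph) (ShareEnd-ι g h ¬pg ¬ph s)
    ... | yes pg | yes ph = ports-coloured-apart c pc g h pg ph g≢h
    ... | no ¬pg | yes ph with ShareEnd-port g h ¬pg ph s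
    ... | y , cy , refl , s′ = λ eq → pc (ι g) y (λ e → Cut⇒¬Inner y cy (subst Inner e (ι-Inner g ¬pg))) s′
                                        (trans eq (sym (cut-colour c pc y cy)))
    restrict-Proper c pc g h g≢h s | yes pg | no ¬ph with ShareEnd-port h g ¬ph pg (ShareEnd-sym G₁ s)
    ... | y , cy , refl , s′ = λ eq → pc (ι h) y (λ e → Cut⇒¬Inner y cy (subst Inner e (ι-Inner h ¬ph))) s′
                                        (trans (sym eq) (sym (cut-colour c pc y cy)))

    restrict-SwitchAt : ∀ {c c′ a b x f} → SwitchAt G c c′ a b x → InAB a b (lookup (restrict c) f) →
      (∀ g → Reach G₁ (restrict c) a b f g → Reach G c a b x (ι g)) →
      (∀ g → Reach G c a b x (ι g) → Reach G₁ (restrict c) a b f g) →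
      SwitchAt G₁ (restrict c) (restrict c′) a b f
    restrict-SwitchAt {c} {c′} {a} {b} (_ , sw) f∈ab to from = f∈ab , λ g →
      (λ r → trans (lookup-restrict c′ g) (trans (proj₁ (sw (ι g)) (to g r)) (cong (swapCol a b) (sym (lookup-restrict c g))))) ,
      (λ ¬r → trans (lookup-restrict c′ g) (trans (proj₂ (sw (ι g)) (¬r ∘ from g)) (sym (lookup-restrict c g))))

    restrict-unswitched : ∀ {c c′ a b x} → SwitchAt G c c′ a b x → (∀ g → ¬ Reach G c a b x (ι g)) →
                          restrict c ≡ restrict c′
    restrict-unswitched {c} {c′} (_ , sw) away = lookup-ext _ _ λ g →
      trans (lookup-restrict c g) (sym (trans (lookup-restrict c′ g) (proj₂ (sw (ι g)) (away g))))

    module AtColours (c : Col₃ G) (pc : Proper G c) (a b : Fin 3) (a≢b : a ≢ b) where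
      c₁ : Col₃ G₁
      c₁ = restrict c

      InAB-ι : ∀ g → InAB a b (lookup c₁ g) → InAB a b (lookup c (ι g))
      InAB-ι g = subst (InAB a b) (lookup-restrict c g)

      InAB-ι⁻ : ∀ g → InAB a b (lookup c (ι g)) → InAB a b (lookup c₁ g)
      InAB-ι⁻ g = subst (InAB a b) (sym (lookup-restrict c g))

      InAB-cutPort : ∀ y → Cut y → InAB a b (lookup c y) → InAB a b (lookup c (ι (cutPort y)))
      InAB-cutPort y cy = subst (InAB a b) (cut-colour c pc y cy)

      InAB-cutPort⁻ : ∀ y → Cut y → InAB a b (lookup c (ι (cutPort y))) → InAB a b (lookup c y)
      InAB-cutPort⁻ y cy = subst (InAB a b) (sym (cut-colour c pc y cy))

      module AvoidingCut (f : Fin (E G₁)) (¬pf : ¬ Port f) (avoids : ∀ y → Cut y → ¬ Reach G c a b (ι f) y) where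

        forward : ∀ g → Reach G₁ c₁ a b f g → ¬ Port g × Reach G c a b (ι f) (ι g)
        forward g here = ¬pf , here
        forward g (step {h} r s q) with forward h r | Port? g
        ... | ¬ph , rh | no ¬pg = ¬pg , step rh (ShareEnd-ι h g ¬ph ¬pg s) (InAB-ι g q)
        ... | ¬ph , rh | yes pg with ShareEnd-port h g ¬ph pg s
        ... | y , cy , refl , s′ = ⊥-elim (avoids y cy (step rh s′ (InAB-cutPort⁻ y cy (InAB-ι _ q))))

        backward-Inner : ∀ y → Reach G c a b (ι f) y →
                         Inner y × Σ (Fin (E G₁)) λ g → ¬ Port g × ι g ≡ y × Reach G₁ c₁ a b f g
        backward-Inner y here = ι-Inner f ¬pf , f , ¬pf , refl , here
        backward-Inner z (step {y} r s q) with backward-Inner y r | Inner? z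
        ... | iy , g , ¬pg , refl , rg | yes iz with Inner-ι⁻ z iz
        ... | h , ¬ph , refl = iz , h , ¬ph , refl , step rg (ShareEnd-ι⁻ g h ¬pg ¬ph s) (InAB-ι⁻ h q)
        backward-Inner z (step {y} r s q) | iy , g , ¬pg , refl , rg | no ¬iz with Cut? z
        ... | yes cz = ⊥-elim (avoids z cz (step r s q))
        ... | no ¬cz = ⊥-elim (outer-¬ShareEnd-inner z (ι g) ¬iz ¬cz iy (ShareEnd-sym G s))

        backward : ∀ g → Reach G c a b (ι f) (ι g) → Reach G₁ c₁ a b f g
        backward g rg with backward-Inner (ι g) rg
        ... | ig , h , ¬ph , e , rh with Port? g
        ... | yes pg = ⊥-elim (Cut⇒¬Inner (ι g) (ι-Cut g pg) ig)
        ... | no ¬pg = subst (Reach G₁ c₁ a b f) (ι-injective h g ¬ph ¬pg e) rh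

      -- Via the ports, a chain of G through a cut edge x is the chain of G₁ through the port of x.
      module ThroughCut (x : Fin (E G)) (cx : Cut x) (x∈ab : InAB a b (lookup c x)) where
        p₀ : Fin (E G₁)
        p₀ = cutPort x

        p₀∈ab : InAB a b (lookup c₁ p₀)
        p₀∈ab = InAB-ι⁻ p₀ (InAB-cutPort x cx x∈ab)

        forward : ∀ g → Reach G₁ c₁ a b p₀ g → Reach G c a b x (ι g)
        forward g here = cuts-linked c pc a b a≢b x (ι p₀) cx (ι-Cut p₀ (cutPort-Port x cx)) x∈ab (InAB-cutPort x cx x∈ab)
        forward g (step {h} r s q) with Port? g
        ... | yes pg = cuts-linked c pc a b a≢b x (ι g) cx (ι-Cut g pg) x∈ab (InAB-ι g q)
        ... | no ¬pg with Port? h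
        ... | no ¬ph = step (forward h r) (ShareEnd-ι h g ¬ph ¬pg s) (InAB-ι g q)
        ... | yes ph with ShareEnd-port g h ¬pg ph (ShareEnd-sym G₁ s)
        ... | y , cy , refl , s′ =
              step (cuts-linked c pc a b a≢b x y cx cy x∈ab (InAB-cutPort⁻ y cy (InAB-ι _ (Reach-InAB G₁ p₀∈ab r))))
                   (ShareEnd-sym G s′) (InAB-ι g q)

        Traced : Fin (E G) → Set
        Traced y = (Inner y → Σ (Fin (E G₁)) λ g → ¬ Port g × ι g ≡ y × Reach G₁ c₁ a b p₀ g) ×
                   (Cut y → Reach G₁ c₁ a b p₀ (cutPort y))

        traced : ∀ y → Reach G c a b x y → Traced y
        traced y here = (λ iy → ⊥-elim (Cut⇒¬Inner x cx iy)) , (λ _ → here)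
        traced z (step {y} r s q) = inner , cut
          where
          cut : Cut z → Reach G₁ c₁ a b p₀ (cutPort z)
          cut cz = step here (ports-ShareEnd p₀ (cutPort z) (cutPort-Port x cx) (cutPort-Port z cz))
                        (InAB-ι⁻ _ (InAB-cutPort z cz q))
          inner : Inner z → Σ (Fin (E G₁)) λ g → ¬ Port g × ι g ≡ z × Reach G₁ c₁ a b p₀ g
          inner iz with Inner-ι⁻ z iz | traced y r | Inner? y | Cut? y
          ... | h , ¬ph , refl | ty , _ | yes iy | _ with ty iy
          ... | g , ¬pg , refl , rg = h , ¬ph , refl , step rg (ShareEnd-ι⁻ g h ¬pg ¬ph s) (InAB-ι⁻ h q)
          inner iz | h , ¬ph , refl | _ , ty | no _ | yes cy =
            h , ¬ph , refl , step (ty cy) (ShareEnd-sym G₁ (ShareEnd-cut h y ¬ph cy (ShareEnd-sym G s))) (InAB-ι⁻ h q)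
          inner iz | h , ¬ph , refl | _ | no ¬iy | no ¬cy = ⊥-elim (outer-¬ShareEnd-inner y (ι h) ¬iy ¬cy iz s)

        backward : ∀ g → Reach G c a b x (ι g) → Reach G₁ c₁ a b p₀ g
        backward g rg with traced (ι g) rg | Port? g
        ... | _ , tc | yes pg = subst (Reach G₁ c₁ a b p₀) (cutPort-ι g pg) (tc (ι-Cut g pg))
        ... | ti , _ | no ¬pg with ti (ι-Inner g ¬pg)
        ... | h , ¬ph , e , rh = subst (Reach G₁ c₁ a b p₀) (ι-injective h g ¬ph ¬pg e) rh

    -- A switch in G restricts to at most one switch in G₁.
    restrict-KempeSwitch : ∀ (c c′ : Col₃ G) → Proper G c → KempeSwitch G c c′ → KempeEquiv G₁ (restrict c) (restrict c′)
    restrict-KempeSwitch c c′ pc (a , b , x , x∈ab , sw) with a ≟ b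
    ... | yes refl = subst (KempeEquiv G₁ (restrict c)) (cong restrict (sym (SwitchAt-refl G {c = c} {w = c′} (x∈ab , sw)))) ε
    ... | no a≢b with any? (λ y → Cut? y ×-dec Reach? G c a b x y)
    ... | yes (y , cy , rxy) = (a , b , cutPort y ,
          restrict-SwitchAt {c′ = c′} (x∈ab , sw) p₀∈ab (λ g r → Reach-trans G rxy (forward g r))
                            (λ g r → backward g (Reach-trans G (Reach-sym G x∈ab rxy) r))) ◅ ε
      where
      open AtColours c pc a b a≢b
      open ThroughCut y cy (Reach-InAB G x∈ab rxy)
    ... | no no-cut with Inner? x
    ... | yes ix with Inner-ι⁻ x ix
    ... | f , ¬pf , refl = (a , b , f ,
          restrict-SwitchAt {c′ = c′} (x∈ab , sw) (InAB-ι⁻ f x∈ab) (λ g r → proj₂ (forward g r)) backward) ◅ ε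
      where
      open AtColours c pc a b a≢b
      open AvoidingCut f ¬pf (λ y cy rxy → no-cut (y , cy , rxy))
    restrict-KempeSwitch c c′ pc (a , b , x , x∈ab , sw) | no a≢b | no no-cut | no ¬ix =
      subst (KempeEquiv G₁ (restrict c)) (restrict-unswitched {c′ = c′} (x∈ab , sw) away) ε
      where
      outer : ∀ y → Reach G c a b x y → ¬ Inner y
      outer y here = ¬ix
      outer z (step {y} r s q) iz with Cut? y
      ... | yes cy = no-cut (y , cy , r)
      ... | no ¬cy = outer-¬ShareEnd-inner y z (outer y r) ¬cy iz s
      away : ∀ g → ¬ Reach G c a b x (ι g)
      away g r with Port? g
      ... | yes pg = no-cut (ι g , ι-Cut g pg , r)
      ... | no ¬pg = outer (ι g) r (ι-Inner g ¬pg)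

    lift-switch : ∀ (c : Col₃ G) → Proper G c → ∀ a b → a ≢ b → (w : Col₃ G₁) (f : Fin (E G₁)) →
      SwitchAt G₁ (restrict c) w a b f → (∀ g → Reach G₁ (restrict c) a b f g → ¬ Port g) →
      Σ (Col₃ G) λ c′ → SwitchAt G c c′ a b (ι f) × restrict c′ ≡ w × (∀ y → ¬ Inner y → lookup c′ y ≡ lookup c y)
    lift-switch c pc a b a≢b w f sw₁@(f∈ab , _) avoid =
      c′ , sw , SwitchAt-unique G₁ (restrict-SwitchAt {c′ = c′} sw f∈ab (λ g r → proj₂ (forward g r)) backward) sw₁ , unchanged
      where
      open AtColours c pc a b a≢b
      ιf∈ab : InAB a b (lookup c (ι f))
      ιf∈ab = InAB-ι f f∈ab
      avoids : ∀ y → Cut y → ¬ Reach G c a b (ι f) y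
      avoids y cy r = avoid (cutPort y) (Reach-sym G₁ p₀∈ab (backward f (Reach-sym G ιf∈ab r))) (cutPort-Port y cy)
        where open ThroughCut y cy (Reach-InAB G ιf∈ab r)
      open AvoidingCut f (avoid f here) avoids
      c′ : Col₃ G
      c′ = switchAt G c a b (ι f)
      sw : SwitchAt G c c′ a b (ι f)
      sw = switchAt-SwitchAt G c a b (ι f) ιf∈ab
      unchanged : ∀ y → ¬ Inner y → lookup c′ y ≡ lookup c y
      unchanged y ¬iy = proj₂ (proj₂ sw y) (λ r → ¬iy (proj₁ (backward-Inner y r)))

    restrict-KempeEquiv : ∀ {c d : Col₃ G} → Proper G c → KempeEquiv G c d → KempeEquiv G₁ (restrict c) (restrict d)
    restrict-KempeEquiv pc ε = ε
    restrict-KempeEquiv {c} pc (_◅_ {j = c′} s ss) =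
      restrict-KempeSwitch c c′ pc s ◅◅ restrict-KempeEquiv (KempeSwitch-Proper G {c′ = c′} pc s) ss

module Decomposition where

  open Colours
  open Chains
  open Switches
  open CutSides
  open import Data.Fin using (Fin; _≟_)
  open import Data.Fin.Properties using (any?)
  open import Data.Vec using (lookup)
  open import Data.List using ([]; _∷_; _++_)
  open import Data.Product using (Σ; _×_; _,_; proj₁; proj₂)
  open import Data.Empty using (⊥-elim)
  open import Relation.Nullary using (¬_; Dec; yes; no; ¬?)
  open import Relation.Nullary.Decidable using (_×-dec_; decidable-stable)
  open import Relation.Binary.PropositionalEquality
  open import Relation.Binary.Construct.Closure.ReflexiveTransitive using (Star; ε; _◅_; _◅◅_)

  record CutDecomposition (G G₁ G₂ : Graph) : Set₁ where
    field
      S₁ : CutSide G G₁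
      S₂ : CutSide G G₂
      Cut₁⇒Cut₂ : ∀ y → CutSide.Cut S₁ y → CutSide.Cut S₂ y
      Cut₂⇒Cut₁ : ∀ y → CutSide.Cut S₂ y → CutSide.Cut S₁ y
      Inner₁⇒¬Inner₂ : ∀ y → CutSide.Inner S₁ y → ¬ CutSide.Inner S₂ y
      outer₁⇒Inner₂ : ∀ y → ¬ CutSide.Inner S₁ y → ¬ CutSide.Cut S₁ y → CutSide.Inner S₂ y

  swap-decomposition : ∀ {G G₁ G₂} → CutDecomposition G G₁ G₂ → CutDecomposition G G₂ G₁
  swap-decomposition D = record
    { S₁ = S₂ ; S₂ = S₁ ; Cut₁⇒Cut₂ = Cut₂⇒Cut₁ ; Cut₂⇒Cut₁ = Cut₁⇒Cut₂
    ; Inner₁⇒¬Inner₂ = λ y i₂ i₁ → Inner₁⇒¬Inner₂ y i₁ i₂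
    ; outer₁⇒Inner₂ = outer₂⇒Inner₁ }
    where
    open CutDecomposition D
    outer₂⇒Inner₁ : ∀ y → ¬ CutSide.Inner S₂ y → ¬ CutSide.Cut S₂ y → CutSide.Inner S₁ y
    outer₂⇒Inner₁ y ¬i₂ ¬c₂ with CutSide.Inner? S₁ y
    ... | yes i₁ = i₁
    ... | no ¬i₁ with CutSide.Cut? S₁ y
    ... | yes c₁ = ⊥-elim (¬c₂ (Cut₁⇒Cut₂ y c₁))
    ... | no ¬c₁ = ⊥-elim (¬i₂ (outer₁⇒Inner₂ y ¬i₁ ¬c₁))

  module Lifting {G G₁ G₂ : Graph} (D : CutDecomposition G G₁ G₂) where
    open CutDecomposition D
    module A = CutSide S₁
    module B = CutSide S₂
    module R₁ = Restriction S₁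
    module R₂ = Restriction S₂

    ι₂-¬Inner₁ : ∀ g → ¬ A.Inner (B.ι g)
    ι₂-¬Inner₁ g with B.Port? g
    ... | yes pg = A.Cut⇒¬Inner _ (Cut₂⇒Cut₁ _ (B.ι-Cut g pg))
    ... | no ¬pg = λ i₁ → Inner₁⇒¬Inner₂ _ i₁ (B.ι-Inner g ¬pg)

    restrict₂-unchanged : ∀ {c c′ : Col₃ G} → (∀ y → ¬ A.Inner y → lookup c′ y ≡ lookup c y) →
                          R₂.restrict c′ ≡ R₂.restrict c
    restrict₂-unchanged {c} {c′} same = lookup-ext _ _ λ g →
      trans (R₂.lookup-restrict c′ g) (trans (same (B.ι g) (ι₂-¬Inner₁ g)) (sym (R₂.lookup-restrict c g)))

    -- Switches inside U lift one by one, provided no a/b-edge of U is a port; this is invariant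
    -- because switches only exchange a and b, hence the comparison with the initial colouring d₀.
    lift-switches : ∀ (a b : Fin 3) → a ≢ b → {U : Fin (E G₁) → Set} (d₀ : Col₃ G₁) →
      (∀ g → U g → A.Port g → ¬ InAB a b (lookup d₀ g)) →
      ∀ (c : Col₃ G) {d d′ : Col₃ G₁} → Proper G c → R₁.restrict c ≡ d →
      (∀ g → InAB a b (lookup d g) → InAB a b (lookup d₀ g)) → Star (SwitchIn G₁ a b U) d d′ →
      Σ (Col₃ G) λ c′ → KempeEquiv G c c′ × R₁.restrict c′ ≡ d′ × R₂.restrict c′ ≡ R₂.restrict c
    lift-switches a b a≢b d₀ no-port c pc eq ab⊆ ε = c , ε , eq , refl
    lift-switches a b a≢b d₀ no-port c {d} pc refl ab⊆ (_◅_ {j = d₁} (f , uf , in-U , sw) rest)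
      with R₁.lift-switch c pc a b a≢b d₁ f sw avoids
      where
      avoids : ∀ g → Reach G₁ d a b f g → ¬ A.Port g
      avoids g r pg = no-port g (in-U g r) pg (ab⊆ g (Reach-InAB G₁ (proj₁ sw) r))
    ... | c₁ , sw′ , eq₁ , unchanged with lift-switches a b a≢b d₀ no-port c₁
          (KempeSwitch-Proper G {c′ = c₁} pc (a , b , A.ι f , sw′)) eq₁ (λ g q → ab⊆ g (SwitchAt-InAB⁻ G₁ {c′ = d₁} sw g q)) rest
    ... | c₂ , ke , eq₂ , same₂ =
          c₂ , (a , b , A.ι f , sw′) ◅ ke , eq₂ , trans same₂ (restrict₂-unchanged {c} {c₁} unchanged)

  module KempeLifting {G G₁ G₂ : Graph} (D : CutDecomposition G G₁ G₂) where
    open CutDecomposition D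
    open Lifting D
    module Swapped = Lifting (swap-decomposition D)

    -- The effect on G₂ of lifting Kempe changes of G₁ is controlled by a permutation of the colours.
    Lift : Col₃ G → Col₃ G₁ → Set
    Lift c w = Σ (Col₃ G) λ c′ → KempeEquiv G c c′ × R₁.restrict c′ ≡ w ×
               Σ Transpositions λ π → R₂.restrict c′ ≡ permuteColouring G₂ π (R₂.restrict c)

    -- After the switch at a cut edge x, exchanging a and b on the a/b-chains of G₂ that the switch
    -- missed completes a global exchange on G₂; these chains avoid the cut, by cuts-linked.
    complete-exchange₂ : ∀ (c : Col₃ G) → Proper G c → ∀ a b → a ≢ b → ∀ x → A.Cut x → (x∈ab : InAB a b (lookup c x)) →
      Σ (Col₃ G) λ c″ → KempeEquiv G (switchAt G c a b x) c″ × R₁.restrict c″ ≡ R₁.restrict (switchAt G c a b x) ×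
                        R₂.restrict c″ ≡ permuteColouring G₂ ((a , b) ∷ []) (R₂.restrict c)
    complete-exchange₂ c pc a b a≢b x cx x∈ab = c″ , ke , eq₁ , trans eq₂ swapped₂
      where
      c′ : Col₃ G
      c′ = switchAt G c a b x
      sw : SwitchAt G c c′ a b x
      sw = switchAt-SwitchAt G c a b x x∈ab
      module X = R₂.AtColours.ThroughCut c pc a b a≢b x (Cut₁⇒Cut₂ x cx) x∈ab
      d₂ : Col₃ G₂
      d₂ = R₂.restrict c′
      Unswitched : Fin (E G₂) → Set
      Unswitched g = ¬ Reach G c a b x (B.ι g)
      unswitched? : ∀ g → Dec (Unswitched g)
      unswitched? g = ¬? (Reach? G c a b x (B.ι g))
      d₂-InAB⁻ : ∀ g → InAB a b (lookup d₂ g) → InAB a b (lookup (R₂.restrict c) g)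
      d₂-InAB⁻ g q = subst (InAB a b) (sym (R₂.lookup-restrict c g))
        (SwitchAt-InAB⁻ G {c′ = c′} sw (B.ι g) (subst (InAB a b) (R₂.lookup-restrict c′ g) q))
      closed : ∀ g h → Unswitched g → InAB a b (lookup d₂ g) → Reach G₂ d₂ a b g h → Unswitched h
      closed g h ug qg rgh rh = ug (X.forward g (Reach-trans G₂ (X.backward h rh)
                                   (Reach-sym G₂ (d₂-InAB⁻ g qg) (Reach-transport G₂ d₂-InAB⁻ rgh))))
      no-port : ∀ g → Unswitched g → B.Port g → ¬ InAB a b (lookup d₂ g)
      no-port g ug pg q = ug (A.cuts-linked c pc a b a≢b x (B.ι g) cx (Cut₂⇒Cut₁ _ (B.ι-Cut g pg)) x∈ab
                               (subst (InAB a b) (R₂.lookup-restrict c g) (d₂-InAB⁻ g q)))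
      module Rest = SwitchUnion G₂ d₂ a b unswitched? closed
      lifted : Σ (Col₃ G) λ c″ → KempeEquiv G c′ c″ × R₂.restrict c″ ≡ Rest.target × R₁.restrict c″ ≡ R₁.restrict c′
      lifted = Swapped.lift-switches a b a≢b d₂ no-port c′
                 (KempeSwitch-Proper G {c′ = c′} pc (a , b , x , sw)) refl (λ _ q → q) Rest.result
      c″ : Col₃ G
      c″ = proj₁ lifted
      ke : KempeEquiv G c′ c″
      ke = proj₁ (proj₂ lifted)
      eq₂ : R₂.restrict c″ ≡ Rest.target
      eq₂ = proj₁ (proj₂ (proj₂ lifted))
      eq₁ : R₁.restrict c″ ≡ R₁.restrict c′
      eq₁ = proj₂ (proj₂ (proj₂ lifted))
      swapped₂ : Rest.target ≡ permuteColouring G₂ ((a , b) ∷ []) (R₂.restrict c)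
      swapped₂ = lookup-ext _ _ λ g → trans (eq g (unswitched? g)) (sym (lookup-permuteColouring G₂ ((a , b) ∷ []) (R₂.restrict c) g))
        where
        eq : ∀ g → Dec (Unswitched g) → lookup Rest.target g ≡ swapCol a b (lookup (R₂.restrict c) g)
        eq g (yes ug) = trans (recolourWhere-in G₂ d₂ unswitched? (swapCol a b) g ug) (cong (swapCol a b)
          (trans (R₂.lookup-restrict c′ g) (trans (proj₂ (proj₂ sw (B.ι g)) ug) (sym (R₂.lookup-restrict c g)))))
        eq g (no ¬ug) = trans (recolourWhere-out G₂ d₂ unswitched? (swapCol a b) g ¬ug)
          (trans (R₂.lookup-restrict c′ g) (trans (proj₁ (proj₂ sw (B.ι g)) (decidable-stable (Reach? G c a b x (B.ι g)) ¬ug))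
            (cong (swapCol a b) (sym (R₂.lookup-restrict c g)))))

    -- A switch of G₁ on a chain through a port p is the switch of G at the cut edge of p, followed by complete-exchange₂.
    lift-port-switch : ∀ (c : Col₃ G) → Proper G c → ∀ a b → a ≢ b → (w : Col₃ G₁) (f p : Fin (E G₁)) →
      SwitchAt G₁ (R₁.restrict c) w a b f → A.Port p → Reach G₁ (R₁.restrict c) a b f p →
      Σ (Col₃ G) λ c″ → KempeEquiv G c c″ × R₁.restrict c″ ≡ w ×
                         R₂.restrict c″ ≡ permuteColouring G₂ ((a , b) ∷ []) (R₂.restrict c)
    lift-port-switch c pc a b a≢b w f p sw₁@(f∈ab , _) pp rfp =
      let c″ , ke , eq₁ , eq₂ = complete-exchange₂ c pc a b a≢b x cx x∈ab
      in c″ , (a , b , x , sw) ◅ ke , trans eq₁ switched₁ , eq₂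
      where
      x : Fin (E G)
      x = A.ι p
      cx : A.Cut x
      cx = A.ι-Cut p pp
      x∈ab : InAB a b (lookup c x)
      x∈ab = subst (InAB a b) (R₁.lookup-restrict c p) (Reach-InAB G₁ f∈ab rfp)
      sw : SwitchAt G c (switchAt G c a b x) a b x
      sw = switchAt-SwitchAt G c a b x x∈ab
      module X = R₁.AtColours.ThroughCut c pc a b a≢b x cx x∈ab
      via-port : ∀ {g} → Reach G₁ (R₁.restrict c) a b f g → Reach G₁ (R₁.restrict c) a b (A.cutPort x) g
      via-port r = subst (λ e → Reach G₁ _ a b e _) (sym (A.cutPort-ι p pp)) (Reach-trans G₁ (Reach-sym G₁ f∈ab rfp) r)
      from-port : ∀ {g} → Reach G₁ (R₁.restrict c) a b (A.cutPort x) g → Reach G₁ (R₁.restrict c) a b f g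
      from-port r = Reach-trans G₁ rfp (subst (λ e → Reach G₁ _ a b e _) (A.cutPort-ι p pp) r)
      switched₁ : R₁.restrict (switchAt G c a b x) ≡ w
      switched₁ = SwitchAt-unique G₁ (R₁.restrict-SwitchAt {c′ = switchAt G c a b x} sw f∈ab
        (λ g r → X.forward g (via-port r)) (λ g r → from-port (X.backward g r))) sw₁

    lift-KempeSwitch : ∀ c → Proper G c → ∀ w → KempeSwitch G₁ (R₁.restrict c) w → Lift c w
    lift-KempeSwitch c pc w (a , b , f , sw₁) with a ≟ b
    ... | yes refl = c , ε , sym (SwitchAt-refl G₁ {w = w} sw₁) , [] , sym (permuteColouring-[] G₂ _)
    ... | no a≢b with any? (λ p → A.Port? p ×-dec Reach? G₁ (R₁.restrict c) a b f p)
    ... | yes (p , pp , rfp) with lift-port-switch c pc a b a≢b w f p sw₁ pp rfp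
    ...   | c″ , ke , eq₁ , eq₂ = c″ , ke , eq₁ , ((a , b) ∷ []) , eq₂
    lift-KempeSwitch c pc w (a , b , f , sw₁) | no a≢b | no no-port
      with R₁.lift-switch c pc a b a≢b w f sw₁ (λ g r pg → no-port (g , pg , r))
    ... | c′ , sw , eq , unchanged =
          c′ , (a , b , A.ι f , sw) ◅ ε , eq , [] ,
          trans (restrict₂-unchanged {c} {c′} unchanged) (sym (permuteColouring-[] G₂ _))

    lift-KempeEquiv : ∀ c → Proper G c → ∀ {d} w → R₁.restrict c ≡ d → KempeEquiv G₁ d w → Lift c w
    lift-KempeEquiv c pc w refl ε = c , ε , refl , [] , sym (permuteColouring-[] G₂ _)
    lift-KempeEquiv c pc w refl (_◅_ {j = w₁} s ss) with lift-KempeSwitch c pc w₁ s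
    ... | c₁ , ke₁ , eq₁ , π₁ , e₁ with lift-KempeEquiv c₁ (KempeEquiv-Proper G pc ke₁) w eq₁ ss
    ... | c₂ , ke₂ , eq₂ , π₂ , e₂ = c₂ , ke₁ ◅◅ ke₂ , eq₂ , π₂ ++ π₁ , (begin
      R₂.restrict c₂                                                          ≡⟨ e₂ ⟩
      permuteColouring G₂ π₂ (R₂.restrict c₁)                                 ≡⟨ cong (permuteColouring G₂ π₂) e₁ ⟩
      permuteColouring G₂ π₂ (permuteColouring G₂ π₁ (R₂.restrict c))         ≡⟨ permuteColouring-++ G₂ π₂ π₁ (R₂.restrict c) ⟩
      permuteColouring G₂ (π₂ ++ π₁) (R₂.restrict c)                          ∎)
      where open ≡-Reasoning

module Gluing {G G₁ G₂ : Graph} (D : Decomposition.CutDecomposition G G₁ G₂) where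
  open Chains
  open CutSides
  open Decomposition
  open import Data.Fin using (Fin)
  open import Data.Vec using (lookup; tabulate)
  open import Data.Vec.Properties using (lookup∘tabulate)
  open import Data.Product using (_,_; proj₁)
  open import Data.Empty using (⊥-elim)
  open import Function using (_∘_)
  open import Relation.Nullary using (¬_; Dec; yes; no)
  open import Relation.Binary.PropositionalEquality
  open CutDecomposition D
  open Lifting D using (module A; module B; module R₁; module R₂)

  Compatible : Col₃ G₁ → Col₃ G₂ → Set
  Compatible c₁ c₂ = ∀ y → A.Cut y → lookup c₁ (A.cutPort y) ≡ lookup c₂ (B.cutPort y)

  data Kind (y : Fin (E G)) : Set where
    inner₁ : A.Inner y → Kind y
    cut : A.Cut y → Kind y
    inner₂ : B.Inner y → Kind y

  kind : ∀ y → Kind y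
  kind y with A.Inner? y
  ... | yes i₁ = inner₁ i₁
  ... | no ¬i₁ with A.Cut? y
  ... | yes cy = cut cy
  ... | no ¬cy = inner₂ (outer₁⇒Inner₂ y ¬i₁ ¬cy)

  colourOf : Col₃ G₁ → Col₃ G₂ → (y : Fin (E G)) → Kind y → Fin 3
  colourOf c₁ c₂ y (inner₁ i₁) = lookup c₁ (proj₁ (A.Inner-ι⁻ y i₁))
  colourOf c₁ c₂ y (cut _) = lookup c₁ (A.cutPort y)
  colourOf c₁ c₂ y (inner₂ i₂) = lookup c₂ (proj₁ (B.Inner-ι⁻ y i₂))

  glue : Col₃ G₁ → Col₃ G₂ → Col₃ G
  glue c₁ c₂ = tabulate (λ y → colourOf c₁ c₂ y (kind y))

  module _ (c₁ : Col₃ G₁) (c₂ : Col₃ G₂) where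

    lookup-glue : ∀ y → lookup (glue c₁ c₂) y ≡ colourOf c₁ c₂ y (kind y)
    lookup-glue = lookup∘tabulate (λ y → colourOf c₁ c₂ y (kind y))

    glue-ι₁ : ∀ g → ¬ A.Port g → lookup (glue c₁ c₂) (A.ι g) ≡ lookup c₁ g
    glue-ι₁ g ¬pg = trans (lookup-glue (A.ι g)) (at (kind (A.ι g)))
      where
      at : (k : Kind (A.ι g)) → colourOf c₁ c₂ (A.ι g) k ≡ lookup c₁ g
      at (inner₁ i₁) with A.Inner-ι⁻ (A.ι g) i₁
      ... | g′ , ¬pg′ , e = cong (lookup c₁) (A.ι-injective g′ g ¬pg′ ¬pg e)
      at (cut cy) = ⊥-elim (A.Cut⇒¬Inner _ cy (A.ι-Inner g ¬pg))
      at (inner₂ i₂) = ⊥-elim (Inner₁⇒¬Inner₂ _ (A.ι-Inner g ¬pg) i₂)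

    glue-cut : ∀ y → A.Cut y → lookup (glue c₁ c₂) y ≡ lookup c₁ (A.cutPort y)
    glue-cut y cy = trans (lookup-glue y) (at (kind y))
      where
      at : (k : Kind y) → colourOf c₁ c₂ y k ≡ lookup c₁ (A.cutPort y)
      at (inner₁ i₁) = ⊥-elim (A.Cut⇒¬Inner _ cy i₁)
      at (cut _) = refl
      at (inner₂ i₂) = ⊥-elim (B.Cut⇒¬Inner _ (Cut₁⇒Cut₂ y cy) i₂)

    glue-ι₂ : ∀ g → ¬ B.Port g → lookup (glue c₁ c₂) (B.ι g) ≡ lookup c₂ g
    glue-ι₂ g ¬pg = trans (lookup-glue (B.ι g)) (at (kind (B.ι g)))
      where
      at : (k : Kind (B.ι g)) → colourOf c₁ c₂ (B.ι g) k ≡ lookup c₂ g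
      at (inner₁ i₁) = ⊥-elim (Inner₁⇒¬Inner₂ _ i₁ (B.ι-Inner g ¬pg))
      at (cut cy) = ⊥-elim (B.Cut⇒¬Inner _ (Cut₁⇒Cut₂ _ cy) (B.ι-Inner g ¬pg))
      at (inner₂ i₂) with B.Inner-ι⁻ (B.ι g) i₂
      ... | g′ , ¬pg′ , e = cong (lookup c₂) (B.ι-injective g′ g ¬pg′ ¬pg e)

    restrict₁-glue : R₁.restrict (glue c₁ c₂) ≡ c₁
    restrict₁-glue = lookup-ext _ _ λ g → trans (R₁.lookup-restrict (glue c₁ c₂) g) (at g (A.Port? g))
      where
      at : ∀ g → Dec (A.Port g) → lookup (glue c₁ c₂) (A.ι g) ≡ lookup c₁ g
      at g (no ¬pg) = glue-ι₁ g ¬pg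
      at g (yes pg) = trans (glue-cut _ (A.ι-Cut g pg)) (cong (lookup c₁) (A.cutPort-ι g pg))

    restrict₂-glue : Compatible c₁ c₂ → R₂.restrict (glue c₁ c₂) ≡ c₂
    restrict₂-glue compatible = lookup-ext _ _ λ g → trans (R₂.lookup-restrict (glue c₁ c₂) g) (at g (B.Port? g))
      where
      at : ∀ g → Dec (B.Port g) → lookup (glue c₁ c₂) (B.ι g) ≡ lookup c₂ g
      at g (no ¬pg) = glue-ι₂ g ¬pg
      at g (yes pg) = trans (glue-cut _ cy) (trans (compatible _ cy) (cong (lookup c₂) (B.cutPort-ι g pg)))
        where cy = Cut₂⇒Cut₁ _ (B.ι-Cut g pg)

    -- Cut edges sharing an end must have different ports for the glued colouring to be proper.
    module _ (cut-ports-apart : ∀ y z → A.Cut y → A.Cut z → y ≢ z → ShareEnd G y z → A.cutPort y ≢ A.cutPort z)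
             (pc₁ : Proper G₁ c₁) (pc₂ : Proper G₂ c₂) (compatible : Compatible c₁ c₂) where

      private
        c : Col₃ G
        c = glue c₁ c₂

        inner₁-cut : ∀ y z → A.Inner y → A.Cut z → ShareEnd G y z → lookup c y ≢ lookup c z
        inner₁-cut y z i₁ cz s eq with A.Inner-ι⁻ y i₁
        ... | g , ¬pg , refl = pc₁ g (A.cutPort z) (λ e → ¬pg (subst A.Port (sym e) (A.cutPort-Port z cz)))
          (A.ShareEnd-cut g z ¬pg cz s) (trans (sym (glue-ι₁ g ¬pg)) (trans eq (glue-cut z cz)))

        inner₂-cut : ∀ y z → B.Inner y → A.Cut z → ShareEnd G y z → lookup c y ≢ lookup c z
        inner₂-cut y z i₂ cz s eq with B.Inner-ι⁻ y i₂
        ... | g , ¬pg , refl = pc₂ g (B.cutPort z) (λ e → ¬pg (subst B.Port (sym e) (B.cutPort-Port z cz₂)))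
          (B.ShareEnd-cut g z ¬pg cz₂ s) (trans (sym (glue-ι₂ g ¬pg)) (trans eq (trans (glue-cut z cz) (compatible z cz))))
          where cz₂ = Cut₁⇒Cut₂ z cz

        inner₁-¬ShareEnd-inner₂ : ∀ y z → A.Inner y → B.Inner z → ¬ ShareEnd G y z
        inner₁-¬ShareEnd-inner₂ y z i₁ i₂ s = A.outer-¬ShareEnd-inner z y (λ i → Inner₁⇒¬Inner₂ z i i₂)
          (λ cz → B.Cut⇒¬Inner z (Cut₁⇒Cut₂ z cz) i₂) i₁ (ShareEnd-sym G s)

      glue-Proper : Proper G c
      glue-Proper y z y≢z s = by-kind (kind y) (kind z)
        where
        by-kind : Kind y → Kind z → lookup c y ≢ lookup c z
        by-kind (inner₁ iy) (inner₁ iz) eq with A.Inner-ι⁻ y iy | A.Inner-ι⁻ z iz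
        ... | g , ¬pg , refl | h , ¬ph , refl = pc₁ g h (y≢z ∘ cong A.ι) (A.ShareEnd-ι⁻ g h ¬pg ¬ph s)
              (trans (sym (glue-ι₁ g ¬pg)) (trans eq (glue-ι₁ h ¬ph)))
        by-kind (inner₁ iy) (cut cz) = inner₁-cut y z iy cz s
        by-kind (inner₁ iy) (inner₂ iz) = ⊥-elim (inner₁-¬ShareEnd-inner₂ y z iy iz s)
        by-kind (cut cy) (inner₁ iz) = inner₁-cut z y iz cy (ShareEnd-sym G s) ∘ sym
        by-kind (cut cy) (cut cz) eq = pc₁ (A.cutPort y) (A.cutPort z) (cut-ports-apart y z cy cz y≢z s)
              (A.ports-ShareEnd _ _ (A.cutPort-Port y cy) (A.cutPort-Port z cz))
              (trans (sym (glue-cut y cy)) (trans eq (glue-cut z cz)))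
        by-kind (cut cy) (inner₂ iz) = inner₂-cut z y iz cy (ShareEnd-sym G s) ∘ sym
        by-kind (inner₂ iy) (inner₁ iz) = ⊥-elim (inner₁-¬ShareEnd-inner₂ z y iz iy (ShareEnd-sym G s))
        by-kind (inner₂ iy) (cut cz) = inner₂-cut y z iy cz s
        by-kind (inner₂ iy) (inner₂ iz) eq with B.Inner-ι⁻ y iy | B.Inner-ι⁻ z iz
        ... | g , ¬pg , refl | h , ¬ph , refl = pc₂ g h (y≢z ∘ cong B.ι) (B.ShareEnd-ι⁻ g h ¬pg ¬ph s)
              (trans (sym (glue-ι₂ g ¬pg)) (trans eq (glue-ι₂ h ¬ph)))

  glue-restrict : ∀ c → Proper G c → glue (R₁.restrict c) (R₂.restrict c) ≡ c
  glue-restrict c pc = lookup-ext _ _ λ y → trans (lookup-glue _ _ y) (at y (kind y))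
    where
    at : ∀ y → (k : Kind y) → colourOf (R₁.restrict c) (R₂.restrict c) y k ≡ lookup c y
    at y (inner₁ i₁) with A.Inner-ι⁻ y i₁
    ... | g , _ , e = trans (R₁.lookup-restrict c g) (cong (lookup c) e)
    at y (cut cy) = trans (R₁.lookup-restrict c _) (sym (A.cut-colour c pc y cy))
    at y (inner₂ i₂) with B.Inner-ι⁻ y i₂
    ... | g , _ , e = trans (R₂.lookup-restrict c g) (cong (lookup c) e)

  restrict-Compatible : ∀ c → Proper G c → Compatible (R₁.restrict c) (R₂.restrict c)
  restrict-Compatible c pc y cy = trans (R₁.lookup-restrict c _) (trans (sym (A.cut-colour c pc y cy))
    (trans (B.cut-colour c pc y (Cut₁⇒Cut₂ y cy)) (sym (R₂.lookup-restrict c _))))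

module Product where

  open Colours
  open Chains
  open Switches
  open CutSides
  open Decomposition
  open import Data.Nat using (ℕ; _*_)
  open import Data.Fin using (Fin; combine)
  open import Data.Fin.Properties using (combine-injective; combine-surjective)
  open import Data.Vec using (lookup)
  open import Data.List using ([]; _∷_)
  open import Data.Product using (Σ; ∃; _×_; _,_; proj₁; proj₂)
  open import Data.Sum using (inj₁; inj₂)
  open import Data.Unit using (⊤; tt)
  open import Function using (_∘_)
  open import Function.Bundles using (_⇔_; mk⇔; Equivalence)
  open import Relation.Nullary using (¬_; yes)
  open import Relation.Binary.PropositionalEquality
  open import Relation.Binary.Construct.Closure.ReflexiveTransitive using (ε; _◅◅_)

  KempeClasses-product : ∀ {G G₁ G₂ : Graph} {n a b : ℕ}
    (res₁ : ProperColouring G n → ProperColouring G₁ n) (res₂ : ProperColouring G n → ProperColouring G₂ n) →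
    (∀ c₁ c₂ → Σ (ProperColouring G n) λ c →
       KempeEquiv G₁ (proj₁ (res₁ c)) (proj₁ c₁) × KempeEquiv G₂ (proj₁ (res₂ c)) (proj₁ c₂)) →
    (∀ c d → KempeEquiv G (proj₁ c) (proj₁ d) →
       KempeEquiv G₁ (proj₁ (res₁ c)) (proj₁ (res₁ d)) × KempeEquiv G₂ (proj₁ (res₂ c)) (proj₁ (res₂ d))) →
    (∀ c d → KempeEquiv G₁ (proj₁ (res₁ c)) (proj₁ (res₁ d)) → KempeEquiv G₂ (proj₁ (res₂ c)) (proj₁ (res₂ d)) →
       KempeEquiv G (proj₁ c) (proj₁ d)) →
    KempeClasses G₁ n a → KempeClasses G₂ n b → KempeClasses G n (a * b)
  KempeClasses-product {G} {n = n} {a} {b} res₁ res₂ realise restrict-equiv equiv-from-restrictions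
                       (cls₁ , onto₁ , iff₁) (cls₂ , onto₂ , iff₂) = cls , onto , iff
    where
    cls : ProperColouring G n → Fin (a * b)
    cls c = combine (cls₁ (res₁ c)) (cls₂ (res₂ c))
    onto : ∀ k → ∃ λ c → cls c ≡ k
    onto k with combine-surjective {a} {b} k
    ... | i , j , refl with onto₁ i | onto₂ j
    ... | c₁ , refl | c₂ , refl with realise c₁ c₂
    ... | c , ke₁ , ke₂ = c , cong₂ combine (Equivalence.from (iff₁ _ c₁) ke₁) (Equivalence.from (iff₂ _ c₂) ke₂)
    iff : ∀ c d → (cls c ≡ cls d) ⇔ KempeEquiv G (proj₁ c) (proj₁ d)
    iff c d = mk⇔ to from
      where
      to : cls c ≡ cls d → KempeEquiv G (proj₁ c) (proj₁ d)
      to eq with combine-injective _ _ _ _ eq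
      ... | eq₁ , eq₂ = equiv-from-restrictions c d (Equivalence.to (iff₁ _ _) eq₁) (Equivalence.to (iff₂ _ _) eq₂)
      from : KempeEquiv G (proj₁ c) (proj₁ d) → cls c ≡ cls d
      from ke with restrict-equiv c d ke
      ... | ke₁ , ke₂ = cong₂ combine (Equivalence.from (iff₁ _ _) ke₁) (Equivalence.from (iff₂ _ _) ke₂)

  record Gluable {G G₁ G₂ : Graph} (D : CutDecomposition G G₁ G₂) : Set where
    open CutDecomposition D
    open Gluing D using (Compatible)
    field
      cut-ports-apart : ∀ y z → CutSide.Cut S₁ y → CutSide.Cut S₁ z → y ≢ z → ShareEnd G y z →
                        CutSide.cutPort S₁ y ≢ CutSide.cutPort S₁ z
      some-cut : Σ (Fin (E G)) (CutSide.Cut S₁)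
      matching : ∀ (c₁ : Col₃ G₁) (c₂ : Col₃ G₂) → Proper G₁ c₁ → Proper G₂ c₂ →
                 Σ Transpositions λ π → Compatible c₁ (permuteColouring G₂ π c₂)

  module _ {G G₁ G₂ : Graph} (D : CutDecomposition G G₁ G₂) (gluable : Gluable D) where
    open CutDecomposition D
    open Gluing D
    open Gluable gluable
    open Lifting D
    module Lift₁ = KempeLifting D
    module Lift₂ = KempeLifting (swap-decomposition D)

    glue-Proper′ : ∀ c₁ c₂ → Proper G₁ c₁ → Proper G₂ c₂ → Compatible c₁ c₂ → Proper G (glue c₁ c₂)
    glue-Proper′ c₁ c₂ = glue-Proper c₁ c₂ cut-ports-apart

    -- The u/v-chains of G₁ miss the ports, so they lift to G one by one without touching G₂.
    glue-swap₁ : ∀ (x₁ : Col₃ G₁) (y₂ : Col₃ G₂) → Proper G₁ x₁ → Proper G₂ y₂ → Compatible x₁ y₂ →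
      ∀ u v → u ≢ v → (∀ p → A.Port p → ¬ InAB u v (lookup x₁ p)) →
      KempeEquiv G (glue x₁ y₂) (glue (permuteColouring G₁ ((u , v) ∷ []) x₁) y₂)
    glue-swap₁ x₁ y₂ px₁ py₂ compat u v u≢v no-port = subst (KempeEquiv G (glue x₁ y₂)) final ke
      where
      module Everywhere = SwitchUnion G₁ x₁ u v {U = λ _ → ⊤} (λ _ → yes tt) (λ _ _ _ _ _ → tt)
      pc : Proper G (glue x₁ y₂)
      pc = glue-Proper′ x₁ y₂ px₁ py₂ compat
      lifted : Σ (Col₃ G) λ c → KempeEquiv G (glue x₁ y₂) c × R₁.restrict c ≡ Everywhere.target × R₂.restrict c ≡ R₂.restrict (glue x₁ y₂)
      lifted = lift-switches u v u≢v x₁ (λ g _ → no-port g) (glue x₁ y₂) pc (restrict₁-glue x₁ y₂) (λ _ q → q) Everywhere.result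
      c : Col₃ G
      c = proj₁ lifted
      ke : KempeEquiv G (glue x₁ y₂) c
      ke = proj₁ (proj₂ lifted)
      target : Everywhere.target ≡ permuteColouring G₁ ((u , v) ∷ []) x₁
      target = lookup-ext _ _ λ g → trans (recolourWhere-in G₁ x₁ {U = λ _ → ⊤} (λ _ → yes tt) (swapCol u v) g tt)
                                          (sym (lookup-permuteColouring G₁ ((u , v) ∷ []) x₁ g))
      final : c ≡ glue (permuteColouring G₁ ((u , v) ∷ []) x₁) y₂
      final = trans (sym (glue-restrict c (KempeEquiv-Proper G pc ke)))
        (cong₂ glue (trans (proj₁ (proj₂ (proj₂ lifted))) target)
                    (trans (proj₂ (proj₂ (proj₂ lifted))) (restrict₂-glue x₁ y₂ compat)))

    permutation-fixes-ports : ∀ (x₁ : Col₃ G₁) (y₂ : Col₃ G₂) (ρ : Transpositions) →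
      Compatible x₁ y₂ → Compatible (permuteColouring G₁ ρ x₁) y₂ → ∀ p → A.Port p → permute ρ (lookup x₁ p) ≡ lookup x₁ p
    permutation-fixes-ports x₁ y₂ ρ compat compat′ p pp = begin
      permute ρ (lookup x₁ p)                                ≡⟨ cong (permute ρ ∘ lookup x₁) (A.cutPort-ι p pp) ⟨
      permute ρ (lookup x₁ (A.cutPort (A.ι p)))              ≡⟨ lookup-permuteColouring G₁ ρ x₁ _ ⟨
      lookup (permuteColouring G₁ ρ x₁) (A.cutPort (A.ι p))  ≡⟨ compat′ _ (A.ι-Cut p pp) ⟩
      lookup y₂ (B.cutPort (A.ι p))                          ≡⟨ compat _ (A.ι-Cut p pp) ⟨
      lookup x₁ (A.cutPort (A.ι p))                          ≡⟨ cong (lookup x₁) (A.cutPort-ι p pp) ⟩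
      lookup x₁ p                                            ∎
      where open ≡-Reasoning

    -- ρ fixes the colour of every port, so it is trivial or exchanges the two colours missing at a cut edge.
    glue-permute₁ : ∀ (x₁ : Col₃ G₁) (y₂ : Col₃ G₂) → Proper G₁ x₁ → Proper G₂ y₂ → (ρ : Transpositions) →
      Compatible x₁ y₂ → Compatible (permuteColouring G₁ ρ x₁) y₂ →
      KempeEquiv G (glue x₁ y₂) (glue (permuteColouring G₁ ρ x₁) y₂)
    glue-permute₁ x₁ y₂ px₁ py₂ ρ compat compat′
      with fixing-permutation (permute ρ) (permute-injective ρ) (lookup x₁ (A.cutPort y))
             (permutation-fixes-ports x₁ y₂ ρ compat compat′ (A.cutPort y) (A.cutPort-Port y (proj₂ some-cut)))
      where y = proj₁ some-cut
    ... | inj₁ identity = subst (λ e → KempeEquiv G (glue x₁ y₂) (glue e y₂))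
            (lookup-ext _ _ λ g → sym (trans (lookup-permuteColouring G₁ ρ x₁ g) (identity _))) ε
    ... | inj₂ transposition = subst (λ e → KempeEquiv G (glue x₁ y₂) (glue e y₂)) permuted
            (glue-swap₁ x₁ y₂ px₁ py₂ compat u v u≢v λ p pp p∈uv →
              swapCol-moves u v _ u≢v p∈uv (trans (sym (transposition _)) (permutation-fixes-ports x₁ y₂ ρ compat compat′ p pp)))
      where
      x : Fin 3
      x = lookup x₁ (A.cutPort (proj₁ some-cut))
      u : Fin 3
      u = other₁ x
      v : Fin 3
      v = other₂ x
      u≢v : u ≢ v
      u≢v = proj₂ (proj₂ (others-distinct x))
      permuted : permuteColouring G₁ ((u , v) ∷ []) x₁ ≡ permuteColouring G₁ ρ x₁
      permuted = lookup-ext _ _ λ g → trans (lookup-permuteColouring G₁ ((u , v) ∷ []) x₁ g)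
                   (sym (trans (lookup-permuteColouring G₁ ρ x₁ g) (transposition _)))

    private
      res₁ : ProperColouring G 3 → ProperColouring G₁ 3
      res₁ (c , pc) = R₁.restrict c , R₁.restrict-Proper c pc
      res₂ : ProperColouring G 3 → ProperColouring G₂ 3
      res₂ (c , pc) = R₂.restrict c , R₂.restrict-Proper c pc

    realise : ∀ c₁ c₂ → Σ (ProperColouring G 3) λ c →
              KempeEquiv G₁ (proj₁ (res₁ c)) (proj₁ c₁) × KempeEquiv G₂ (proj₁ (res₂ c)) (proj₁ c₂)
    realise (c₁ , pc₁) (c₂ , pc₂) with matching c₁ c₂ pc₁ pc₂
    ... | π , compat = (glue c₁ c₂′ , glue-Proper′ c₁ c₂′ pc₁ (permuteColouring-Proper G₂ π c₂ pc₂) compat) ,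
          subst (λ e → KempeEquiv G₁ e c₁) (sym (restrict₁-glue c₁ c₂′)) ε ,
          subst (λ e → KempeEquiv G₂ e c₂) (sym (restrict₂-glue c₁ c₂′ compat))
                (KempeEquiv-sym G₂ (KempeEquiv-permuteColouring G₂ π c₂))
      where c₂′ = permuteColouring G₂ π c₂

    -- Lift the change of the first side (this permutes the colours of the second side), then the
    -- corrected change of the second side (this permutes the colours of the first side); what
    -- remains is the permutation of the first side, handled by glue-permute₁.
    KempeEquiv-from-restrictions : ∀ c d → KempeEquiv G₁ (proj₁ (res₁ c)) (proj₁ (res₁ d)) →
      KempeEquiv G₂ (proj₁ (res₂ c)) (proj₁ (res₂ d)) → KempeEquiv G (proj₁ c) (proj₁ d)
    KempeEquiv-from-restrictions (c , pc) (d , pd) ke₁ ke₂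
      with Lift₁.lift-KempeEquiv c pc (R₁.restrict d) refl ke₁
    ... | c′ , kc′ , eq₁ , π , eq₂
      with Lift₂.lift-KempeEquiv c′ (KempeEquiv-Proper G pc kc′) (R₂.restrict d) refl
             (subst (λ e → KempeEquiv G₂ e (R₂.restrict d)) (sym eq₂)
                    (KempeEquiv-sym G₂ (KempeEquiv-permuteColouring G₂ π (R₂.restrict c)) ◅◅ ke₂))
    ... | c″ , kc″ , eq₂′ , ρ , eq₁′ =
          kc′ ◅◅ kc″ ◅◅ subst₂ (KempeEquiv G) (sym c″≡glue) (glue-restrict d pd) (KempeEquiv-sym G permuted)
      where
      pc″ : Proper G c″
      pc″ = KempeEquiv-Proper G (KempeEquiv-Proper G pc kc′) kc″
      restrict₁-c″ : R₁.restrict c″ ≡ permuteColouring G₁ ρ (R₁.restrict d)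
      restrict₁-c″ = trans eq₁′ (cong (permuteColouring G₁ ρ) eq₁)
      c″≡glue : c″ ≡ glue (permuteColouring G₁ ρ (R₁.restrict d)) (R₂.restrict d)
      c″≡glue = trans (sym (glue-restrict c″ pc″)) (cong₂ glue restrict₁-c″ eq₂′)
      permuted = glue-permute₁ (R₁.restrict d) (R₂.restrict d) (R₁.restrict-Proper d pd) (R₂.restrict-Proper d pd) ρ
                   (restrict-Compatible d pd) (subst₂ Compatible restrict₁-c″ eq₂′ (restrict-Compatible c″ pc″))

    KempeClasses-decomposition : ∀ {a b} → KempeClasses G₁ 3 a → KempeClasses G₂ 3 b → KempeClasses G 3 (a * b)
    KempeClasses-decomposition = KempeClasses-product res₁ res₂ realise
      (λ (c , pc) (d , pd) ke → R₁.restrict-KempeEquiv pc ke , R₂.restrict-KempeEquiv pc ke)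
      KempeEquiv-from-restrictions

module Incidence where

  open import Data.Fin using (Fin)
  open import Data.Product using (Σ; _×_; _,_; proj₁; proj₂)
  open import Data.Sum using (_⊎_; inj₁; inj₂)
  open import Function.Bundles using (_↔_; mk↔ₛ′)
  open import Relation.Binary.PropositionalEquality
  open import Relation.Nullary using (¬_; Dec; yes; no)
  open import Data.Unit using (⊤; tt)
  open import Data.Empty using (⊥; ⊥-elim)

  EndOf : {W : Set} → W → W × W → Set
  EndOf z P = proj₁ P ≡ z ⊎ proj₂ P ≡ z

  module _ {A : Set} where

    SameEnds-refl : (P : A × A) → SameEnds P P
    SameEnds-refl P = inj₁ (refl , refl)

    SameEnds-trans : (P Q R : A × A) → SameEnds P Q → SameEnds Q R → SameEnds P R
    SameEnds-trans P Q R (inj₁ (a , b)) (inj₁ (c , d)) = inj₁ (trans a c , trans b d)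
    SameEnds-trans P Q R (inj₁ (a , b)) (inj₂ (c , d)) = inj₂ (trans a c , trans b d)
    SameEnds-trans P Q R (inj₂ (a , b)) (inj₁ (c , d)) = inj₂ (trans a d , trans b c)
    SameEnds-trans P Q R (inj₂ (a , b)) (inj₂ (c , d)) = inj₁ (trans a d , trans b c)

    SameEnds-map : {B : Set} (h : A → B) (P Q : A × A) → SameEnds P Q → SameEnds (map× h P) (map× h Q)
    SameEnds-map h P Q (inj₁ (a , b)) = inj₁ (cong h a , cong h b)
    SameEnds-map h P Q (inj₂ (a , b)) = inj₂ (cong h a , cong h b)

    SameEnds-EndOf : (P Q : A × A) → SameEnds P Q → ∀ z → EndOf z P → EndOf z Q
    SameEnds-EndOf P Q (inj₁ (a , b)) z (inj₁ e) = inj₁ (trans (sym a) e)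
    SameEnds-EndOf P Q (inj₁ (a , b)) z (inj₂ e) = inj₂ (trans (sym b) e)
    SameEnds-EndOf P Q (inj₂ (a , b)) z (inj₁ e) = inj₂ (trans (sym a) e)
    SameEnds-EndOf P Q (inj₂ (a , b)) z (inj₂ e) = inj₁ (trans (sym b) e)

    SameEnds-EndOf⁻ : (P Q : A × A) → SameEnds P Q → ∀ z → EndOf z Q → EndOf z P
    SameEnds-EndOf⁻ P Q (inj₁ (a , b)) z (inj₁ e) = inj₁ (trans a e)
    SameEnds-EndOf⁻ P Q (inj₁ (a , b)) z (inj₂ e) = inj₂ (trans b e)
    SameEnds-EndOf⁻ P Q (inj₂ (a , b)) z (inj₁ e) = inj₂ (trans b e)
    SameEnds-EndOf⁻ P Q (inj₂ (a , b)) z (inj₂ e) = inj₁ (trans a e)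

    EndOf-map× : {B : Set} (h : A → B) {a : A} (P : A × A) → EndOf a P → EndOf (h a) (map× h P)
    EndOf-map× h P (inj₁ e) = inj₁ (cong h e)
    EndOf-map× h P (inj₂ e) = inj₂ (cong h e)

    EndOf-map×⁻ : {B : Set} (h : A → B) (P : A × A) {z : B} → EndOf z (map× h P) → Σ A λ a → z ≡ h a × EndOf a P
    EndOf-map×⁻ h P (inj₁ e) = proj₁ P , sym e , inj₁ refl
    EndOf-map×⁻ h P (inj₂ e) = proj₂ P , sym e , inj₂ refl

  module EndsVia (G : Graph) {W : Set} (fv : Fin (V G) → W) (fv-injective : ∀ u w → fv u ≡ fv w → u ≡ w)
                 (ends′ : Fin (E G) → W × W) (ends-ok : ∀ x → SameEnds (map× fv (ends G x)) (ends′ x)) where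

    Inc⇒EndOf : ∀ u x → Inc G u x → EndOf (fv u) (ends′ x)
    Inc⇒EndOf u x i = SameEnds-EndOf _ _ (ends-ok x) (fv u) (EndOf-map× fv (ends G x) i)

    EndOf⇒Inc : ∀ z x → EndOf z (ends′ x) → Σ (Fin (V G)) λ u → Inc G u x × fv u ≡ z
    EndOf⇒Inc z x p with EndOf-map×⁻ fv (ends G x) (SameEnds-EndOf⁻ _ _ (ends-ok x) z p)
    ... | u , refl , i = u , i , refl

    ShareEnd⇒common-end : ∀ x y → ShareEnd G x y → Σ W λ z → EndOf z (ends′ x) × EndOf z (ends′ y)
    ShareEnd⇒common-end x y (u , i , j) = fv u , Inc⇒EndOf u x i , Inc⇒EndOf u y j

    common-end⇒ShareEnd : ∀ x y z → EndOf z (ends′ x) → EndOf z (ends′ y) → ShareEnd G x y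
    common-end⇒ShareEnd x y z p q with EndOf⇒Inc z x p | EndOf⇒Inc z y q
    ... | u , i , refl | u′ , j , e = u , i , subst (λ k → Inc G k y) (fv-injective u′ u e) j

  module _ {A B C : Set} where

    exchange : A ⊎ B ⊎ C → B ⊎ A ⊎ C
    exchange (inj₁ a) = inj₂ (inj₁ a)
    exchange (inj₂ (inj₁ b)) = inj₁ b
    exchange (inj₂ (inj₂ c)) = inj₂ (inj₂ c)

  exchange-involutive : ∀ {A B C : Set} (t : A ⊎ B ⊎ C) → exchange (exchange t) ≡ t
  exchange-involutive (inj₁ a) = refl
  exchange-involutive (inj₂ (inj₁ b)) = refl
  exchange-involutive (inj₂ (inj₂ c)) = refl

  exchange-↔ : ∀ {A B C : Set} → (A ⊎ B ⊎ C) ↔ (B ⊎ A ⊎ C)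
  exchange-↔ = mk↔ₛ′ exchange exchange exchange-involutive exchange-involutive

  module _ {A B C : Set} where

    Left Cross : A ⊎ B ⊎ C → Set
    Left (inj₁ _) = ⊤
    Left (inj₂ _) = ⊥
    Cross (inj₂ (inj₂ _)) = ⊤
    Cross _ = ⊥

    Left? : ∀ t → Dec (Left t)
    Left? (inj₁ _) = yes tt
    Left? (inj₂ _) = no λ ()

    Cross? : ∀ t → Dec (Cross t)
    Cross? (inj₁ _) = no λ ()
    Cross? (inj₂ (inj₁ _)) = no λ ()
    Cross? (inj₂ (inj₂ _)) = yes tt

    Cross⇒¬Left : ∀ t → Cross t → ¬ Left t
    Cross⇒¬Left (inj₂ (inj₂ _)) _ ()

  Cross-exchange : ∀ {A B C : Set} (t : A ⊎ B ⊎ C) → Cross t → Cross (exchange t)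
  Cross-exchange (inj₂ (inj₂ _)) _ = tt

  Left⇒¬Left-exchange : ∀ {A B C : Set} (t : A ⊎ B ⊎ C) → Left t → ¬ Left (exchange t)
  Left⇒¬Left-exchange (inj₁ _) _ ()

  outer⇒Left-exchange : ∀ {A B C : Set} (t : A ⊎ B ⊎ C) → ¬ Left t → ¬ Cross t → Left (exchange t)
  outer⇒Left-exchange (inj₁ _) ¬l _ = ⊥-elim (¬l tt)
  outer⇒Left-exchange (inj₂ (inj₁ _)) _ _ = tt
  outer⇒Left-exchange (inj₂ (inj₂ _)) _ ¬c = ⊥-elim (¬c tt)

  Cross-exchange⁻ : ∀ {A B C : Set} (t : A ⊎ B ⊎ C) → Cross (exchange t) → Cross t
  Cross-exchange⁻ (inj₂ (inj₂ _)) _ = tt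

-- G is assembled from parts of G₁ and G₂ plus some new cross edges, up to the isomorphisms fv, emap.
module Composed (G₁ G₂ G : Graph) {P₁ : Fin (E G₁) → Set} {P₂ : Fin (E G₂) → Set} {X : Set}
  (fv : Fin (V G) → Fin (V G₁) ⊎ Fin (V G₂)) (fv-injective : ∀ u w → fv u ≡ fv w → u ≡ w)
  (emap : Fin (E G) ↔ (Σ (Fin (E G₁)) P₁ ⊎ Σ (Fin (E G₂)) P₂ ⊎ X))
  (ends′ : Σ (Fin (E G₁)) P₁ ⊎ Σ (Fin (E G₂)) P₂ ⊎ X → (Fin (V G₁) ⊎ Fin (V G₂)) × (Fin (V G₁) ⊎ Fin (V G₂)))
  (ends′-left : ∀ f p → ends′ (inj₁ (f , p)) ≡ map× inj₁ (ends G₁ f))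
  (ends′-right : ∀ f p → ends′ (inj₂ (inj₁ (f , p))) ≡ map× inj₂ (ends G₂ f))
  (ends-ok : ∀ y → SameEnds (map× fv (ends G y)) (ends′ (Inverse.to emap y))) where
  open Incidence
  open import Data.Fin using (Fin)
  open import Data.Product using (Σ; _×_; _,_)
  open import Data.Sum using (_⊎_; inj₁; inj₂)
  open import Data.Unit using (tt)
  open import Data.Empty using (⊥-elim)
  open import Function using (_∘_)
  open import Function.Bundles using (_↔_; Inverse)
  open import Relation.Nullary using (¬_)
  open import Relation.Binary.PropositionalEquality

  τ : Fin (E G) → Σ (Fin (E G₁)) P₁ ⊎ Σ (Fin (E G₂)) P₂ ⊎ X
  τ = Inverse.to emap

  σ : Σ (Fin (E G₁)) P₁ ⊎ Σ (Fin (E G₂)) P₂ ⊎ X → Fin (E G)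
  σ = Inverse.from emap

  τσ : ∀ t → τ (σ t) ≡ t
  τσ = Inverse.strictlyInverseˡ emap

  τ-injective : ∀ x y → τ x ≡ τ y → x ≡ y
  τ-injective x y e = trans (sym (Inverse.strictlyInverseʳ emap x))
                            (trans (cong σ e) (Inverse.strictlyInverseʳ emap y))

  open EndsVia G fv fv-injective (ends′ ∘ τ) ends-ok public

  EndOf-left⁻ : ∀ {y f p z} → τ y ≡ inj₁ (f , p) → EndOf z (ends′ (τ y)) →
                Σ (Fin (V G₁)) λ u → z ≡ inj₁ u × Inc G₁ u f
  EndOf-left⁻ {f = f} {p} eq q = EndOf-map×⁻ inj₁ (ends G₁ f) (subst (EndOf _) (trans (cong ends′ eq) (ends′-left f p)) q)

  EndOf-left : ∀ {y f p u} → τ y ≡ inj₁ (f , p) → Inc G₁ u f → EndOf (inj₁ u) (ends′ (τ y))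
  EndOf-left {f = f} {p} eq i = subst (EndOf _) (sym (trans (cong ends′ eq) (ends′-left f p))) (EndOf-map× inj₁ (ends G₁ f) i)

  right-¬ShareEnd-left : ∀ y z → ¬ Left (τ y) → ¬ Cross (τ y) → Left (τ z) → ¬ ShareEnd G y z
  right-¬ShareEnd-left y z ¬ly ¬cy lz s with ShareEnd⇒common-end y z s | τ y in ey | τ z in ez
  ... | _ | inj₁ _ | _ = ¬ly tt
  ... | _ | inj₂ (inj₂ _) | _ = ¬cy tt
  ... | _ | inj₂ (inj₁ _) | inj₂ _ = ⊥-elim lz
  ... | w , p , q | inj₂ (inj₁ (h , ph)) | inj₁ (g , pg)
    with EndOf-map×⁻ inj₂ (ends G₂ h) (subst (EndOf w) (trans (cong ends′ ey) (ends′-right h ph)) p)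
       | EndOf-left⁻ {z} ez q
  ... | _ , refl , _ | _ , () , _

module Parity where

  open Counting
  open Colours using (AllDifferent; triple; triple-η; allDifferent?; AllDifferent-triple; AllDifferent-triple⁻)
  open import Data.Nat using (ℕ; suc; _+_; _*_)
  open import Data.Nat.DivMod using (_%_; [m+kn]%n≡m%n; m*n%n≡0)
  import Data.Nat.Properties as ℕ
  open import Data.Nat.Tactic.RingSolver using (solve-∀)
  open import Data.Fin using (Fin; zero; suc; _≟_)
  open import Data.Fin.Properties using (all?)
  open import Data.List using ([]; _∷_; filter; allFin; length)
  open import Data.List.Membership.Propositional using (_∈_)
  open import Data.List.Relation.Unary.Unique.Propositional using (Unique)
  open import Data.List.Relation.Unary.Any using (here; there)
  open import Data.List.Relation.Unary.AllPairs using ([]; _∷_)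
  open import Data.List.Relation.Unary.All using ([]; _∷_)
  open import Data.List.Relation.Unary.Unique.Propositional.Properties using (filter⁺; allFin⁺)
  open import Data.List.Membership.Propositional.Properties using (∈-filter⁺; ∈-filter⁻; ∈-allFin)
  open import Data.Product using (Σ; _,_; proj₁; proj₂)
  open import Data.Empty using (⊥-elim)
  open import Function using (_∘_)
  open import Relation.Nullary using (Dec; yes; no)
  open import Relation.Nullary.Decidable using (_×-dec_; _→-dec_; toWitness)
  open import Relation.Binary.PropositionalEquality

  record EdgesAt (H : Graph) (u : Fin (V H)) : Set where
    field
      edge : Fin 3 → Fin (E H)
      edge-injective : ∀ i j → edge i ≡ edge j → i ≡ j
      edge-Inc : ∀ j → Inc H u (edge j)
      Inc⇒edge : ∀ g → Inc H u g → Σ (Fin 3) λ j → edge j ≡ g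

  module _ (H : Graph) (u : Fin (V H)) where

    private
      fromList : ∀ L → Unique L → length L ≡ 3 → (∀ g → g ∈ L → Inc H u g) → (∀ g → Inc H u g → g ∈ L) → EdgesAt H u
      fromList (e₀ ∷ e₁ ∷ e₂ ∷ []) ((e₀≢e₁ ∷ e₀≢e₂ ∷ []) ∷ (e₁≢e₂ ∷ []) ∷ [] ∷ []) refl incident listed = record
        { edge = edge ; edge-injective = injective ; edge-Inc = λ j → incident _ (member j) ; Inc⇒edge = onto }
        where
        edge : Fin 3 → Fin (E H)
        edge zero = e₀
        edge (suc zero) = e₁
        edge (suc (suc zero)) = e₂
        member : ∀ j → edge j ∈ (e₀ ∷ e₁ ∷ e₂ ∷ [])
        member zero = here refl
        member (suc zero) = there (here refl)
        member (suc (suc zero)) = there (there (here refl))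
        injective : ∀ i j → edge i ≡ edge j → i ≡ j
        injective zero zero _ = refl
        injective zero (suc zero) e = ⊥-elim (e₀≢e₁ e)
        injective zero (suc (suc zero)) e = ⊥-elim (e₀≢e₂ e)
        injective (suc zero) zero e = ⊥-elim (e₀≢e₁ (sym e))
        injective (suc zero) (suc zero) _ = refl
        injective (suc zero) (suc (suc zero)) e = ⊥-elim (e₁≢e₂ e)
        injective (suc (suc zero)) zero e = ⊥-elim (e₀≢e₂ (sym e))
        injective (suc (suc zero)) (suc zero) e = ⊥-elim (e₁≢e₂ (sym e))
        injective (suc (suc zero)) (suc (suc zero)) _ = refl
        onto : ∀ g → Inc H u g → Σ (Fin 3) λ j → edge j ≡ g
        onto g i with listed g i
        ... | here refl = zero , refl
        ... | there (here refl) = suc zero , refl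
        ... | there (there (here refl)) = suc (suc zero) , refl

    edgesAt : degree H u ≡ 3 → EdgesAt H u
    edgesAt deg = fromList (filter (inc? H u) (allFin (E H))) (filter⁺ (inc? H u) (allFin⁺ (E H))) deg
      (λ g m → proj₂ (∈-filter⁻ (inc? H u) {xs = allFin (E H)} m)) (λ g i → ∈-filter⁺ (inc? H u) (∈-allFin g) i)

  handshake : (H : Graph) {Q : Fin (E H) → Set} (Q? : ∀ g → Dec (Q g)) →
    sum (λ u → sum (λ g → indicator (inc? H u g ×-dec Q? g))) ≡ sum (λ g → indicator (Q? g) + indicator (Q? g))
  handshake H Q? = trans (∑-comm (λ u g → indicator (inc? H u g ×-dec Q? g))) (sum-cong-≗ twice)
    where
    twice : ∀ g → sum (λ u → indicator (inc? H u g ×-dec Q? g)) ≡ indicator (Q? g) + indicator (Q? g)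
    twice g with Q? g
    ... | no ¬q = sum-zero λ u → indicator-no (inc? H u g ×-dec no ¬q) (¬q ∘ proj₂)
    ... | yes q = begin
      sum (λ u → indicator (inc? H u g ×-dec yes q))                      ≡⟨ sum-cong-≗ one-each ⟩
      sum (λ u → indicator (u ≟ end₁) + indicator (u ≟ end₂))             ≡⟨ ∑-distrib-+ (λ u → indicator (u ≟ end₁)) _ ⟩
      sum (λ u → indicator (u ≟ end₁)) + sum (λ u → indicator (u ≟ end₂)) ≡⟨ cong₂ _+_ (sum-indicator-≟ end₁) (sum-indicator-≟ end₂) ⟩
      2                                                                    ∎
      where
      open ≡-Reasoning
      end₁ : Fin (V H)
      end₁ = proj₁ (ends H g)
      end₂ : Fin (V H)
      end₂ = proj₂ (ends H g)
      one-each : ∀ u → indicator (inc? H u g ×-dec yes q) ≡ indicator (u ≟ end₁) + indicator (u ≟ end₂)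
      one-each u = trans (indicator-cong (inc? H u g ×-dec yes q) (inc? H u g) proj₁ (_, q))
        (trans (indicator-⊎ (end₁ ≟ u) (end₂ ≟ u) (λ (e₁ , e₂) → loopless H g (trans e₁ (sym e₂))))
               (cong₂ _+_ (indicator-cong (end₁ ≟ u) (u ≟ end₁) sym sym) (indicator-cong (end₂ ≟ u) (u ≟ end₂) sym sym)))

  colourCount : (Fin 3 → Fin 3) → Fin 3 → ℕ
  colourCount a x = sum (λ j → indicator (a j ≟ x))

  private
    different-counts-one : ∀ a₀ a₁ a₂ x → AllDifferent (triple a₀ a₁ a₂) → colourCount (triple a₀ a₁ a₂) x ≡ 1
    different-counts-one = toWitness {a? = all? λ a₀ → all? λ a₁ → all? λ a₂ → all? λ x →
      allDifferent? a₀ a₁ a₂ →-dec (colourCount (triple a₀ a₁ a₂) x ℕ.≟ 1)} _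

    even-sums⇒AllDifferent : ∀ a₀ a₁ a₂ →
      (∀ x y → (colourCount (triple a₀ a₁ a₂) x + colourCount (triple a₀ a₁ a₂) y) % 2 ≡ 0) → AllDifferent (triple a₀ a₁ a₂)
    even-sums⇒AllDifferent = toWitness {a? = all? λ a₀ → all? λ a₁ → all? λ a₂ →
      (all? λ x → all? λ y → (colourCount (triple a₀ a₁ a₂) x + colourCount (triple a₀ a₁ a₂) y) % 2 ℕ.≟ 0)
      →-dec allDifferent? a₀ a₁ a₂} _

  colourCount-triple : (a : Fin 3 → Fin 3) → ∀ x → colourCount a x ≡ colourCount (triple (a zero) (a (suc zero)) (a (suc (suc zero)))) x
  colourCount-triple a x = sum-cong-≗ λ j → cong (λ c → indicator (c ≟ x)) (triple-η a j)

  colourCount-AllDifferent : (a : Fin 3 → Fin 3) → AllDifferent a → ∀ x → colourCount a x ≡ 1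
  colourCount-AllDifferent a diff x =
    trans (colourCount-triple a x) (different-counts-one _ _ _ x (AllDifferent-triple a diff))

  AllDifferent-by-parity : (a : Fin 3 → Fin 3) (n : ℕ) (m : Fin 3 → ℕ) →
    (∀ x → colourCount a x + n ≡ 2 * m x + 1) → AllDifferent a
  AllDifferent-by-parity a n m parity = AllDifferent-triple⁻ a (even-sums⇒AllDifferent _ _ _ λ x y →
    subst₂ (λ k l → (k + l) % 2 ≡ 0) (colourCount-triple a x) (colourCount-triple a y) (even-sum x y))
    where
    even-sum : ∀ x y → (colourCount a x + colourCount a y) % 2 ≡ 0
    even-sum x y = begin
      (k + l) % 2                               ≡⟨ [m+kn]%n≡m%n (k + l) (n + 1) 2 ⟨
      (k + l + (n + 1) * 2) % 2                 ≡⟨ cong (_% 2) (regroup k l n) ⟩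
      (k + n + 1 + (l + n + 1)) % 2             ≡⟨ cong (λ s → (s + (l + n + 1)) % 2) (cong (_+ 1) (parity x)) ⟩
      (2 * m x + 1 + 1 + (l + n + 1)) % 2       ≡⟨ cong (λ s → (2 * m x + 1 + 1 + s) % 2) (cong (_+ 1) (parity y)) ⟩
      (2 * m x + 1 + 1 + (2 * m y + 1 + 1)) % 2 ≡⟨ cong (_% 2) (collect (m x) (m y)) ⟩
      ((m x + m y + 2) * 2) % 2                 ≡⟨ m*n%n≡0 (m x + m y + 2) 2 ⟩
      0                                         ∎
      where
      open ≡-Reasoning
      k = colourCount a x
      l = colourCount a y
      regroup : ∀ k l n → k + l + (n + 1) * 2 ≡ k + n + 1 + (l + n + 1)
      regroup = solve-∀
      collect : ∀ s t → 2 * s + 1 + 1 + (2 * t + 1 + 1) ≡ (s + t + 2) * 2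
      collect = solve-∀

  -- Each colour class covers every vertex but w exactly once, so twice its size
  -- is V - 1 plus the number of edges at w of that colour: all colours occur at w equally often modulo 2.
  module _ (H : Graph) (cubic : Cubic H) (col : Fin (E H) → Fin 3) (w : Fin (V H))
           (proper-off-w : ∀ u → u ≢ w → ∀ g h → g ≢ h → Inc H u g → Inc H u h → col g ≢ col h)
           (at-w : EdgesAt H w) where

    private
      size : Fin 3 → ℕ
      size x = sum (λ g → indicator (col g ≟ x))

      incident : Fin 3 → Fin (V H) → ℕ
      incident x u = sum (λ g → indicator (inc? H u g ×-dec (col g ≟ x)))

      incident-edgesAt : ∀ x u (at-u : EdgesAt H u) → incident x u ≡ colourCount (col ∘ EdgesAt.edge at-u) x
      incident-edgesAt x u at-u = sum-over-image edge edge-injective (inc? H u) edge-Inc Inc⇒edge (λ g → col g ≟ x)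
        where open EdgesAt at-u

      incident-off-w : ∀ x u → u ≢ w → incident x u ≡ 1
      incident-off-w x u u≢w = trans (incident-edgesAt x u at-u) (colourCount-AllDifferent (col ∘ edge)
        (λ j k j≢k → proper-off-w u u≢w (edge j) (edge k) (j≢k ∘ edge-injective j k) (edge-Inc j) (edge-Inc k)) x)
        where
        at-u : EdgesAt H u
        at-u = edgesAt H u (cubic u)
        open EdgesAt at-u

      parity : ∀ x → colourCount (col ∘ EdgesAt.edge at-w) x + V H ≡ 2 * size x + 1
      parity x = begin
        colourCount (col ∘ EdgesAt.edge at-w) x + V H    ≡⟨ cong (_+ V H) (incident-edgesAt x w at-w) ⟨
        incident x w + V H                                 ≡⟨ sum-ones-except w (λ u → incident-off-w x u) ⟨
        sum (incident x) + 1                               ≡⟨ cong (_+ 1) (handshake H (λ g → col g ≟ x)) ⟩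
        sum (λ g → indicator (col g ≟ x) + indicator (col g ≟ x)) + 1 ≡⟨ cong (_+ 1) (∑-distrib-+ (λ g → indicator (col g ≟ x)) _) ⟩
        size x + size x + 1                                ≡⟨ cong (λ s → size x + s + 1) (ℕ.+-identityʳ (size x)) ⟨
        2 * size x + 1                                     ∎
        where open ≡-Reasoning

    parity-lemma : AllDifferent (col ∘ EdgesAt.edge at-w)
    parity-lemma = AllDifferent-by-parity (col ∘ EdgesAt.edge at-w) (V H) size parity

module YComposition where

  open Colours
  open Chains
  open Switches
  open CutSides
  open Decomposition
  open Product
  open Parity
  open Incidence
  open import Data.Nat using (_*_)
  open import Data.Fin using (Fin; zero; _≟_)
  open import Data.Vec using (lookup)
  open import Data.Product using (Σ; _×_; _,_; proj₁; proj₂)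
  open import Data.Sum using (_⊎_; inj₁; inj₂; swap)
  open import Data.Sum.Algebra using (⊎-comm)
  open import Data.Unit using (tt)
  open import Data.Empty using (⊥-elim)
  open import Data.Bool.Properties using (T-irrelevant)
  open import Function using (_∘_)
  open import Function.Bundles using (Inverse)
  open import Function.Properties.Inverse using (↔-trans)
  open import Relation.Nullary using (¬_; Dec; yes; no)
  open import Relation.Nullary.Decidable using (False; fromWitnessFalse; toWitnessFalse)
  open import Relation.Binary.PropositionalEquality

  module YPortFacts {H : Graph} (p : YPort H) where
    open YPort p

    e-Inc-v : ∀ j → Inc H v (e j)
    e-Inc-v j with e-ends j
    ... | inj₁ (v≡ , _) = inj₁ v≡
    ... | inj₂ (_ , v≡) = inj₂ v≡

    e-Inc-s : ∀ j → Inc H (s j) (e j)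
    e-Inc-s j with e-ends j
    ... | inj₁ (_ , s≡) = inj₂ s≡
    ... | inj₂ (s≡ , _) = inj₁ s≡

    e-Inc-only : ∀ u j → Inc H u (e j) → u ≡ v ⊎ u ≡ s j
    e-Inc-only u j i with e-ends j
    e-Inc-only u j (inj₁ refl) | inj₁ (v≡ , _) = inj₁ v≡
    e-Inc-only u j (inj₂ refl) | inj₁ (_ , s≡) = inj₂ s≡
    e-Inc-only u j (inj₁ refl) | inj₂ (s≡ , _) = inj₂ s≡
    e-Inc-only u j (inj₂ refl) | inj₂ (_ , v≡) = inj₁ v≡

    edgesAt-v : EdgesAt H v
    edgesAt-v = record { edge = e ; edge-injective = e-inj ; edge-Inc = e-Inc-v ; Inc⇒edge = e-all }

  swapY : ∀ {G₁ G₂ G p₁ p₂} → IsY G₁ G₂ p₁ p₂ G → IsY G₂ G₁ p₂ p₁ G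
  swapY {G₁} {G₂} {G} {p₁} {p₂} isY = record
    { vmap = ↔-trans vmap (⊎-comm _ _) ; emap = ↔-trans emap exchange-↔ ; ends-ok = ends-ok′ }
    where
    open IsY isY
    forget-swap : ∀ o → forgetY G₂ G₁ (YPort.v p₂) (YPort.v p₁) (swap o) ≡ swap (forgetY G₁ G₂ (YPort.v p₁) (YPort.v p₂) o)
    forget-swap (inj₁ _) = refl
    forget-swap (inj₂ _) = refl
    yEnds-swap : ∀ t → SameEnds (map× swap (yEnds G₁ G₂ p₁ p₂ t)) (yEnds G₂ G₁ p₂ p₁ (exchange t))
    yEnds-swap (inj₁ _) = SameEnds-refl _
    yEnds-swap (inj₂ (inj₁ _)) = SameEnds-refl _
    yEnds-swap (inj₂ (inj₂ j)) = inj₂ (refl , refl)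
    ends-ok′ : ∀ f → SameEnds (map× (λ x → forgetY G₂ G₁ (YPort.v p₂) (YPort.v p₁) (swap (Inverse.to vmap x))) (ends G f))
                              (yEnds G₂ G₁ p₂ p₁ (exchange (Inverse.to emap f)))
    ends-ok′ f rewrite forget-swap (Inverse.to vmap (proj₁ (ends G f))) | forget-swap (Inverse.to vmap (proj₂ (ends G f))) =
      SameEnds-trans _ _ _ (SameEnds-map swap _ _ (ends-ok f)) (yEnds-swap (Inverse.to emap f))

  -- G₁ as one side of G₁ Y G₂: the ports are the three edges at v₁, standing for the three new edges.
  module YSide (G₁ G₂ G : Graph) (p₁ : YPort G₁) (p₂ : YPort G₂) (isY : IsY G₁ G₂ p₁ p₂ G) (cubic₁ : Cubic G₁) where
    open IsY isY
    open YPort p₁ using (v; e; s; e-inj; e-all)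
    open YPortFacts p₁

    forgetY-injective : ∀ a b → forgetY G₁ G₂ v (YPort.v p₂) a ≡ forgetY G₁ G₂ v (YPort.v p₂) b → a ≡ b
    forgetY-injective (inj₁ (x , p)) (inj₁ (.x , q)) refl = cong (λ r → inj₁ (x , r)) (T-irrelevant p q)
    forgetY-injective (inj₂ (x , p)) (inj₂ (.x , q)) refl = cong (λ r → inj₂ (x , r)) (T-irrelevant p q)

    fv : Fin (V G) → Fin (V G₁) ⊎ Fin (V G₂)
    fv = forgetY G₁ G₂ v (YPort.v p₂) ∘ Inverse.to vmap

    fv-injective : ∀ u w → fv u ≡ fv w → u ≡ w
    fv-injective u w eq = trans (sym (Inverse.strictlyInverseʳ vmap u))
      (trans (cong (Inverse.from vmap) (forgetY-injective _ _ eq)) (Inverse.strictlyInverseʳ vmap w))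

    open Composed G₁ G₂ G fv fv-injective emap (yEnds G₁ G₂ p₁ p₂) (λ _ _ → refl) (λ _ _ → refl) ends-ok public

    Part : Set
    Part = OldEv G₁ v ⊎ OldEv G₂ (YPort.v p₂) ⊎ Fin 3

    ends′ : Part → (Fin (V G₁) ⊎ Fin (V G₂)) × (Fin (V G₁) ⊎ Fin (V G₂))
    ends′ = yEnds G₁ G₂ p₁ p₂

    embed : ∀ g → Dec (Inc G₁ v g) → Part
    embed g (yes i) = inj₂ (inj₂ (proj₁ (e-all g i)))
    embed g (no ¬i) = inj₁ (g , fromWitnessFalse ¬i)

    ι : Fin (E G₁) → Fin (E G)
    ι g = σ (embed g (inc? G₁ v g))

    τ-ι-off : ∀ g → ¬ Inc G₁ v g → Σ (False (inc? G₁ v g)) λ pf → τ (ι g) ≡ inj₁ (g , pf)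
    τ-ι-off g ¬i = at (inc? G₁ v g)
      where
      at : ∀ d → Σ (False (inc? G₁ v g)) λ pf → τ (σ (embed g d)) ≡ inj₁ (g , pf)
      at (yes i) = ⊥-elim (¬i i)
      at (no _) = fromWitnessFalse ¬i , trans (τσ _) (cong (λ r → inj₁ (g , r)) (T-irrelevant _ _))

    τ-ι-port : ∀ g → Inc G₁ v g → Σ (Fin 3) λ j → e j ≡ g × τ (ι g) ≡ inj₂ (inj₂ j)
    τ-ι-port g i = at (inc? G₁ v g)
      where
      at : ∀ d → Σ (Fin 3) λ j → e j ≡ g × τ (σ (embed g d)) ≡ inj₂ (inj₂ j)
      at (yes i′) = proj₁ (e-all g i′) , proj₂ (e-all g i′) , τσ _
      at (no ¬i) = ⊥-elim (¬i i)

    cutEdge : Fin 3 → Fin (E G)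
    cutEdge j = σ (inj₂ (inj₂ j))

    ι-e : ∀ j → ι (e j) ≡ cutEdge j
    ι-e j with τ-ι-port (e j) (e-Inc-v j)
    ... | k , ek , t rewrite e-inj k j ek = τ-injective _ _ (trans t (sym (τσ _)))

    Cross⇒cutEdge : ∀ y → Cross (τ y) → Σ (Fin 3) λ j → y ≡ cutEdge j
    Cross⇒cutEdge y cy with τ y in eq
    ... | inj₂ (inj₂ j) = j , τ-injective _ _ (trans eq (sym (τσ _)))

    portOf : Part → Fin (E G₁)
    portOf (inj₂ (inj₂ j)) = e j
    portOf _ = e zero  -- junk value, only cross edges have a port

    EndOf-ι : ∀ g u → u ≢ v → Inc G₁ u g → EndOf (inj₁ u) (ends′ (τ (ι g)))
    EndOf-ι g u u≢v i = at (inc? G₁ v g)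
      where
      at : Dec (Inc G₁ v g) → EndOf (inj₁ u) (ends′ (τ (ι g)))
      at (no ¬pg) = EndOf-left {ι g} (proj₂ (τ-ι-off g ¬pg)) i
      at (yes pg) with τ-ι-port g pg
      ... | j , refl , t with e-Inc-only u j i
      ...   | inj₁ u≡v = ⊥-elim (u≢v u≡v)
      ...   | inj₂ refl = subst (λ r → EndOf (inj₁ u) (ends′ r)) (sym t) (inj₁ refl)

    ι-injective : ∀ g h → ι g ≡ ι h → g ≡ h
    ι-injective g h eq = by-cases (inc? G₁ v g) (inc? G₁ v h)
      where
      by-cases : Dec (Inc G₁ v g) → Dec (Inc G₁ v h) → g ≡ h
      by-cases (no ¬pg) (no ¬ph) with τ-ι-off g ¬pg | τ-ι-off h ¬ph
      ... | _ , t | _ , t′ with trans (sym t) (trans (cong τ eq) t′)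
      ...   | refl = refl
      by-cases (yes pg) (yes ph) with τ-ι-port g pg | τ-ι-port h ph
      ... | _ , refl , t | _ , refl , t′ with trans (sym t) (trans (cong τ eq) t′)
      ...   | refl = refl
      by-cases (no ¬pg) (yes ph) with τ-ι-off g ¬pg | τ-ι-port h ph
      ... | _ , t | _ , _ , t′ with trans (sym t) (trans (cong τ eq) t′)
      ...   | ()
      by-cases (yes pg) (no ¬ph) with τ-ι-port g pg | τ-ι-off h ¬ph
      ... | _ , _ , t | _ , t′ with trans (sym t) (trans (cong τ eq) t′)
      ...   | ()

    -- The parity lemma in G₁, where every vertex but v keeps its three edges.
    cut-colours-differ : ∀ (c : Col₃ G) → Proper G c → ∀ j k → j ≢ k → lookup c (cutEdge j) ≢ lookup c (cutEdge k)
    cut-colours-differ c pc j k j≢k eq = parity-lemma G₁ cubic₁ (lookup c ∘ ι) v proper-off-v edgesAt-v j k j≢k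
      (trans (cong (lookup c) (ι-e j)) (trans eq (sym (cong (lookup c) (ι-e k)))))
      where
      proper-off-v : ∀ u → u ≢ v → ∀ g h → g ≢ h → Inc G₁ u g → Inc G₁ u h → lookup c (ι g) ≢ lookup c (ι h)
      proper-off-v u u≢v g h g≢h ig ih = pc (ι g) (ι h) (g≢h ∘ ι-injective g h)
        (common-end⇒ShareEnd (ι g) (ι h) (inj₁ u) (EndOf-ι g u u≢v ig) (EndOf-ι h u u≢v ih))

    Left-ι⁻ : ∀ y → Left (τ y) → Σ (Fin (E G₁)) λ g → ¬ Inc G₁ v g × ι g ≡ y
    Left-ι⁻ y ly with τ y in eq
    ... | inj₁ (g , pf) = g , toWitnessFalse pf , τ-injective _ _
          (trans (proj₂ (τ-ι-off g (toWitnessFalse pf))) (trans (cong (λ r → inj₁ (g , r)) (T-irrelevant _ _)) (sym eq)))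

    portOf-Port : ∀ y → Cross (τ y) → Inc G₁ v (portOf (τ y))
    portOf-Port y cy with τ y
    ... | inj₂ (inj₂ j) = e-Inc-v j

    portOf-ι : ∀ p → Inc G₁ v p → portOf (τ (ι p)) ≡ p
    portOf-ι p pp with τ-ι-port p pp
    ... | j , ej , t rewrite t = ej

    ShareEnd-ι : ∀ g h → ¬ Inc G₁ v g → ¬ Inc G₁ v h → ShareEnd G₁ g h → ShareEnd G (ι g) (ι h)
    ShareEnd-ι g h ¬pg ¬ph (u , i , i′) = common-end⇒ShareEnd (ι g) (ι h) (inj₁ u)
      (EndOf-ι g u (λ { refl → ¬pg i }) i) (EndOf-ι h u (λ { refl → ¬ph i′ }) i′)

    ShareEnd-ι⁻ : ∀ g h → ¬ Inc G₁ v g → ¬ Inc G₁ v h → ShareEnd G (ι g) (ι h) → ShareEnd G₁ g h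
    ShareEnd-ι⁻ g h ¬pg ¬ph sh with ShareEnd⇒common-end (ι g) (ι h) sh
    ... | z , p , q with EndOf-left⁻ {ι g} (proj₂ (τ-ι-off g ¬pg)) p | EndOf-left⁻ {ι h} (proj₂ (τ-ι-off h ¬ph)) q
    ... | u , refl , i | _ , refl , i′ = u , i , i′

    ShareEnd-port : ∀ g p → ¬ Inc G₁ v g → Inc G₁ v p → ShareEnd G₁ g p →
                    Σ (Fin (E G)) λ y → Cross (τ y) × portOf (τ y) ≡ p × ShareEnd G (ι g) y
    ShareEnd-port g p ¬pg pp (u , i , i′) with τ-ι-port p pp
    ... | j , refl , t with e-Inc-only u j i′
    ...   | inj₁ refl = ⊥-elim (¬pg i)
    ...   | inj₂ refl = ι p , subst Cross (sym t) tt , cong portOf t ,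
            common-end⇒ShareEnd (ι g) (ι p) (inj₁ (s j)) (EndOf-ι g (s j) (λ { refl → ¬pg i }) i)
              (subst (λ r → EndOf (inj₁ (s j)) (ends′ r)) (sym t) (inj₁ refl))

    ShareEnd-cut : ∀ g y → ¬ Inc G₁ v g → Cross (τ y) → ShareEnd G (ι g) y → ShareEnd G₁ g (portOf (τ y))
    ShareEnd-cut g y ¬pg cy sh with ShareEnd⇒common-end (ι g) y sh
    ... | z , p , q with EndOf-left⁻ {ι g} (proj₂ (τ-ι-off g ¬pg)) p | Cross⇒cutEdge y cy
    ... | u , refl , i | j , refl rewrite τσ (inj₂ (inj₂ j)) with q
    ...   | inj₁ refl = s j , i , e-Inc-s j

    cut-colour : ∀ (c : Col₃ G) → Proper G c → ∀ y → Cross (τ y) → lookup c y ≡ lookup c (ι (portOf (τ y)))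
    cut-colour c pc y cy with Cross⇒cutEdge y cy
    ... | j , refl rewrite τσ (inj₂ (inj₂ j)) = cong (lookup c) (sym (ι-e j))

    ports-coloured-apart : ∀ (c : Col₃ G) → Proper G c → ∀ p q → Inc G₁ v p → Inc G₁ v q → p ≢ q →
                           lookup c (ι p) ≢ lookup c (ι q)
    ports-coloured-apart c pc p q pp pq p≢q with e-all p pp | e-all q pq
    ... | j , refl | k , refl rewrite ι-e j | ι-e k = cut-colours-differ c pc j k (p≢q ∘ cong e)

    -- Otherwise switching the chain of one cut edge would give two cut edges the same colour.
    cuts-linked : ∀ (c : Col₃ G) → Proper G c → ∀ a b → a ≢ b → ∀ x y → Cross (τ x) → Cross (τ y) →
                  InAB a b (lookup c x) → InAB a b (lookup c y) → Reach G c a b x y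
    cuts-linked c pc a b a≢b x y cx cy x∈ab y∈ab with Reach? G c a b x y
    ... | yes r = r
    ... | no ¬r with Cross⇒cutEdge x cx | Cross⇒cutEdge y cy
    ... | j , refl | k , refl with j ≟ k
    ... | yes refl = ⊥-elim (¬r here)
    ... | no j≢k = ⊥-elim (cut-colours-differ c′ pc′ j k j≢k (trans switched (sym kept)))
      where
      c′ : Col₃ G
      c′ = switchAt G c a b (cutEdge j)
      sw : SwitchAt G c c′ a b (cutEdge j)
      sw = switchAt-SwitchAt G c a b (cutEdge j) x∈ab
      pc′ : Proper G c′
      pc′ = KempeSwitch-Proper G {c′ = c′} pc (a , b , cutEdge j , sw)
      switched : lookup c′ (cutEdge j) ≡ lookup c (cutEdge k)
      switched = trans (proj₁ (proj₂ sw (cutEdge j)) here) (swapCol-exchanges a b _ _ x∈ab y∈ab (cut-colours-differ c pc j k j≢k))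
      kept : lookup c′ (cutEdge k) ≡ lookup c (cutEdge k)
      kept = proj₂ (proj₂ sw (cutEdge k)) ¬r

    side : CutSide G G₁
    side = record
      { ι = ι ; Port = Inc G₁ v ; Port? = inc? G₁ v
      ; Inner = Left ∘ τ ; Inner? = Left? ∘ τ ; Cut = Cross ∘ τ ; Cut? = Cross? ∘ τ ; cutPort = portOf ∘ τ
      ; ι-Inner = λ g ¬pg → subst Left (sym (proj₂ (τ-ι-off g ¬pg))) tt
      ; ι-Cut = λ p pp → subst Cross (sym (proj₂ (proj₂ (τ-ι-port p pp)))) tt
      ; Inner-ι⁻ = Left-ι⁻
      ; ι-injective = λ g h _ _ → ι-injective g h
      ; Cut⇒¬Inner = Cross⇒¬Left ∘ τ
      ; cutPort-Port = portOf-Port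
      ; cutPort-ι = portOf-ι
      ; ShareEnd-ι⁻ = ShareEnd-ι⁻
      ; ShareEnd-ι = ShareEnd-ι
      ; ShareEnd-port = ShareEnd-port
      ; ShareEnd-cut = ShareEnd-cut
      ; ports-ShareEnd = λ p q pp pq → v , pp , pq
      ; outer-¬ShareEnd-inner = right-¬ShareEnd-left
      ; cut-colour = cut-colour
      ; ports-coloured-apart = ports-coloured-apart
      ; cuts-linked = cuts-linked
      }

  module _ (G₁ G₂ G : Graph) (p₁ : YPort G₁) (p₂ : YPort G₂) (isY : IsY G₁ G₂ p₁ p₂ G)
           (cubic₁ : Cubic G₁) (cubic₂ : Cubic G₂) where
    private
      module A = YSide G₁ G₂ G p₁ p₂ isY cubic₁
      module B = YSide G₂ G₁ G p₂ p₁ (swapY isY) cubic₂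

    Y-decomposition : CutDecomposition G G₁ G₂
    Y-decomposition = record
      { S₁ = A.side ; S₂ = B.side
      ; Cut₁⇒Cut₂ = Cross-exchange ∘ A.τ ; Cut₂⇒Cut₁ = Cross-exchange⁻ ∘ A.τ
      ; Inner₁⇒¬Inner₂ = Left⇒¬Left-exchange ∘ A.τ ; outer₁⇒Inner₂ = outer⇒Left-exchange ∘ A.τ }

    Y-gluable : Gluable Y-decomposition
    Y-gluable = record { cut-ports-apart = ports-apart ; some-cut = A.cutEdge zero , subst Cross (sym (A.τσ _)) tt ; matching = matching }
      where
      ports-apart : ∀ y z → Cross (A.τ y) → Cross (A.τ z) → y ≢ z → ShareEnd G y z → A.portOf (A.τ y) ≢ A.portOf (A.τ z)
      ports-apart y z cy cz y≢z _ eq with A.Cross⇒cutEdge y cy | A.Cross⇒cutEdge z cz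
      ... | j , refl | k , refl rewrite A.τσ (inj₂ (inj₂ j)) | A.τσ (inj₂ (inj₂ k)) with YPort.e-inj p₁ j k eq
      ... | refl = y≢z refl
      port-colours-differ : ∀ {H} (p : YPort H) (c : Col₃ H) → Proper H c → AllDifferent (lookup c ∘ YPort.e p)
      port-colours-differ p c pc j k j≢k = pc _ _ (j≢k ∘ YPort.e-inj p j k)
        (YPort.v p , YPortFacts.e-Inc-v p j , YPortFacts.e-Inc-v p k)
      matching : ∀ (c₁ : Col₃ G₁) (c₂ : Col₃ G₂) → Proper G₁ c₁ → Proper G₂ c₂ →
                 Σ Transpositions λ π → Gluing.Compatible Y-decomposition c₁ (permuteColouring G₂ π c₂)
      matching c₁ c₂ pc₁ pc₂ with transpositions-between (lookup c₁ ∘ YPort.e p₁) (lookup c₂ ∘ YPort.e p₂)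
                                    (port-colours-differ p₁ c₁ pc₁) (port-colours-differ p₂ c₂ pc₂)
      ... | π , maps = π , compatible
        where
        compatible : Gluing.Compatible Y-decomposition c₁ (permuteColouring G₂ π c₂)
        compatible y cy with A.Cross⇒cutEdge y cy
        ... | j , refl rewrite A.τσ (inj₂ (inj₂ j)) =
              sym (trans (lookup-permuteColouring G₂ π c₂ (YPort.e p₂ j)) (maps j))

    KempeClasses-Y : ∀ {a b} → KempeClasses G₁ 3 a → KempeClasses G₂ 3 b → KempeClasses G 3 (a * b)
    KempeClasses-Y = KempeClasses-decomposition Y-decomposition Y-gluable

module HComposition where

  open Colours
  open Chains
  open Switches
  open CutSides
  open Decomposition
  open Product
  open Parity
  open Incidence
  open import Data.Nat using (_*_)
  open import Data.Fin using (Fin; zero; suc; _≟_)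
  open import Data.Vec using (lookup)
  open import Data.List using ([]; _∷_)
  open import Data.Product using (Σ; _×_; _,_; proj₁; proj₂)
  open import Data.Sum using (_⊎_; inj₁; inj₂; swap)
  open import Data.Sum.Algebra using (⊎-comm)
  open import Data.Unit using (tt)
  open import Data.Empty using (⊥; ⊥-elim)
  open import Data.Bool.Properties using (T-irrelevant)
  open import Function using (_∘_)
  open import Function.Bundles using (Inverse)
  open import Function.Properties.Inverse using (↔-trans)
  open import Relation.Nullary using (¬_; Dec; yes; no)
  open import Relation.Nullary.Decidable using (False; fromWitnessFalse; toWitnessFalse)
  open import Relation.Binary.PropositionalEquality

  module HPortFacts {H : Graph} (q : HPort H) where
    open HPort q

    d-Inc-s₁ : Inc H s₁ d
    d-Inc-s₁ with d-ends
    ... | inj₁ (s₁≡ , _) = inj₁ s₁≡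
    ... | inj₂ (_ , s₁≡) = inj₂ s₁≡

    d-Inc-s₂ : Inc H s₂ d
    d-Inc-s₂ with d-ends
    ... | inj₁ (_ , s₂≡) = inj₂ s₂≡
    ... | inj₂ (s₂≡ , _) = inj₁ s₂≡

    d-Inc-only : ∀ u → Inc H u d → u ≡ s₁ ⊎ u ≡ s₂
    d-Inc-only u i with d-ends
    d-Inc-only u (inj₁ refl) | inj₁ (s₁≡ , _) = inj₁ s₁≡
    d-Inc-only u (inj₂ refl) | inj₁ (_ , s₂≡) = inj₂ s₂≡
    d-Inc-only u (inj₁ refl) | inj₂ (s₂≡ , _) = inj₂ s₂≡
    d-Inc-only u (inj₂ refl) | inj₂ (_ , s₁≡) = inj₁ s₁≡

    s₁≢s₂ : s₁ ≢ s₂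
    s₁≢s₂ eq with d-ends
    ... | inj₁ (s₁≡ , s₂≡) = loopless H d (trans s₁≡ (trans eq (sym s₂≡)))
    ... | inj₂ (s₂≡ , s₁≡) = loopless H d (trans s₂≡ (trans (sym eq) (sym s₁≡)))

  swapH : ∀ {G₁ G₂ G q₁ q₂} → IsH G₁ G₂ q₁ q₂ G → IsH G₂ G₁ q₂ q₁ G
  swapH {G₁} {G₂} {G} {q₁} {q₂} isH = record
    { vmap = ↔-trans vmap (⊎-comm _ _) ; emap = ↔-trans emap exchange-↔ ; ends-ok = ends-ok′ }
    where
    open IsH isH
    hEnds-swap : ∀ t → SameEnds (map× swap (hEnds G₁ G₂ q₁ q₂ t)) (hEnds G₂ G₁ q₂ q₁ (exchange t))
    hEnds-swap (inj₁ _) = SameEnds-refl _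
    hEnds-swap (inj₂ (inj₁ _)) = SameEnds-refl _
    hEnds-swap (inj₂ (inj₂ zero)) = inj₂ (refl , refl)
    hEnds-swap (inj₂ (inj₂ (suc _))) = inj₂ (refl , refl)
    ends-ok′ : ∀ f → SameEnds (map× (swap ∘ Inverse.to vmap) (ends G f)) (hEnds G₂ G₁ q₂ q₁ (exchange (Inverse.to emap f)))
    ends-ok′ f = SameEnds-trans _ _ _ (SameEnds-map swap _ _ (ends-ok f)) (hEnds-swap (Inverse.to emap f))

  -- G₁ as one side of G₁ H G₂: its single port d stands for both new edges.
  module HSide (G₁ G₂ G : Graph) (q₁ : HPort G₁) (q₂ : HPort G₂) (isH : IsH G₁ G₂ q₁ q₂ G) (cubic₁ : Cubic G₁) where
    open IsH isH
    open HPort q₁ using (d; s₁; s₂)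
    open HPortFacts q₁

    fv-injective : ∀ u w → Inverse.to vmap u ≡ Inverse.to vmap w → u ≡ w
    fv-injective u w eq = trans (sym (Inverse.strictlyInverseʳ vmap u))
      (trans (cong (Inverse.from vmap) eq) (Inverse.strictlyInverseʳ vmap w))

    open Composed G₁ G₂ G (Inverse.to vmap) fv-injective emap (hEnds G₁ G₂ q₁ q₂) (λ _ _ → refl) (λ _ _ → refl) ends-ok public

    Part : Set
    Part = OldEe G₁ d ⊎ OldEe G₂ (HPort.d q₂) ⊎ Fin 2

    ends′ : Part → (Fin (V G₁) ⊎ Fin (V G₂)) × (Fin (V G₁) ⊎ Fin (V G₂))
    ends′ = hEnds G₁ G₂ q₁ q₂

    embed : ∀ g → Dec (g ≡ d) → Part
    embed g (yes _) = inj₂ (inj₂ zero)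
    embed g (no g≢d) = inj₁ (g , fromWitnessFalse g≢d)

    ι : Fin (E G₁) → Fin (E G)
    ι g = σ (embed g (g ≟ d))

    τ-ι-off : ∀ g → g ≢ d → Σ (False (g ≟ d)) λ pf → τ (ι g) ≡ inj₁ (g , pf)
    τ-ι-off g g≢d = at (g ≟ d)
      where
      at : ∀ dec → Σ (False (g ≟ d)) λ pf → τ (σ (embed g dec)) ≡ inj₁ (g , pf)
      at (yes g≡d) = ⊥-elim (g≢d g≡d)
      at (no _) = fromWitnessFalse g≢d , trans (τσ _) (cong (λ r → inj₁ (g , r)) (T-irrelevant _ _))

    cutEdge : Fin 2 → Fin (E G)
    cutEdge i = σ (inj₂ (inj₂ i))

    ι-d : ι d ≡ cutEdge zero
    ι-d = at (d ≟ d)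
      where
      at : ∀ dec → σ (embed d dec) ≡ cutEdge zero
      at (yes _) = refl
      at (no d≢d) = ⊥-elim (d≢d refl)

    Cross⇒cutEdge : ∀ y → Cross (τ y) → Σ (Fin 2) λ i → y ≡ cutEdge i
    Cross⇒cutEdge y cy with τ y in eq
    ... | inj₂ (inj₂ i) = i , τ-injective _ _ (trans eq (sym (τσ _)))

    end : Fin 2 → Fin (V G₁)
    end zero = s₁
    end (suc _) = s₂

    end-Inc : ∀ i → Inc G₁ (end i) d
    end-Inc zero = d-Inc-s₁
    end-Inc (suc _) = d-Inc-s₂

    EndOf-cutEdge : ∀ i → EndOf (inj₁ (end i)) (ends′ (τ (cutEdge i)))
    EndOf-cutEdge zero rewrite τσ (inj₂ (inj₂ zero)) = inj₁ refl
    EndOf-cutEdge (suc k) rewrite τσ (inj₂ (inj₂ (suc k))) = inj₁ refl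

    EndOf-cutEdge⁻ : ∀ i u → EndOf (inj₁ u) (ends′ (τ (cutEdge i))) → u ≡ end i
    EndOf-cutEdge⁻ zero u p rewrite τσ (inj₂ (inj₂ zero)) with p
    ... | inj₁ refl = refl
    EndOf-cutEdge⁻ (suc k) u p rewrite τσ (inj₂ (inj₂ (suc k))) with p
    ... | inj₁ refl = refl

    cutEdge≢ι : ∀ i g → g ≢ d → cutEdge i ≢ ι g
    cutEdge≢ι i g g≢d eq with trans (sym (τσ (inj₂ (inj₂ i)))) (trans (cong τ eq) (proj₂ (τ-ι-off g g≢d)))
    ... | ()

    ι-injective : ∀ g h → ι g ≡ ι h → g ≡ h
    ι-injective g h eq = by-cases (g ≟ d) (h ≟ d)
      where
      by-cases : Dec (g ≡ d) → Dec (h ≡ d) → g ≡ h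
      by-cases (yes g≡d) (yes h≡d) = trans g≡d (sym h≡d)
      by-cases (no g≢d) (no h≢d) with τ-ι-off g g≢d | τ-ι-off h h≢d
      ... | _ , t | _ , t′ with trans (sym t) (trans (cong τ eq) t′)
      ...   | refl = refl
      by-cases (no g≢d) (yes refl) = ⊥-elim (cutEdge≢ι zero g g≢d (trans (sym ι-d) (sym eq)))
      by-cases (yes refl) (no h≢d) = ⊥-elim (cutEdge≢ι zero h h≢d (trans (sym ι-d) eq))

    ShareEnd-cutEdge : ∀ g k → g ≢ d → Inc G₁ (end k) g → ShareEnd G (ι g) (cutEdge k)
    ShareEnd-cutEdge g k g≢d i = common-end⇒ShareEnd (ι g) (cutEdge k) (inj₁ (end k))
      (EndOf-left {ι g} (proj₂ (τ-ι-off g g≢d)) i) (EndOf-cutEdge k)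

    EndOf-ι : ∀ g u → u ≢ s₂ → Inc G₁ u g → EndOf (inj₁ u) (ends′ (τ (ι g)))
    EndOf-ι g u u≢s₂ i = at (g ≟ d)
      where
      at : Dec (g ≡ d) → EndOf (inj₁ u) (ends′ (τ (ι g)))
      at (no g≢d) = EndOf-left {ι g} (proj₂ (τ-ι-off g g≢d)) i
      at (yes refl) with d-Inc-only u i
      ... | inj₂ u≡s₂ = ⊥-elim (u≢s₂ u≡s₂)
      ... | inj₁ refl = subst (λ r → EndOf (inj₁ s₁) (ends′ (τ r))) (sym ι-d) (EndOf-cutEdge zero)

    ι-proper-off-s₂ : ∀ (c : Col₃ G) → Proper G c → ∀ u → u ≢ s₂ → ∀ g h → g ≢ h → Inc G₁ u g → Inc G₁ u h →
                      lookup c (ι g) ≢ lookup c (ι h)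
    ι-proper-off-s₂ c pc u u≢s₂ g h g≢h ig ih = pc (ι g) (ι h) (g≢h ∘ ι-injective g h)
      (common-end⇒ShareEnd (ι g) (ι h) (inj₁ u) (EndOf-ι g u u≢s₂ ig) (EndOf-ι h u u≢s₂ ih))

    -- By the parity lemma at s₂ in G₁, the new edge at s₂ has the colour that d would have there.
    cut-colours-agree : ∀ (c : Col₃ G) → Proper G c → ∀ i k → lookup c (cutEdge i) ≡ lookup c (cutEdge k)
    cut-colours-agree c pc = all-agree
      where
      at-s₂ : EdgesAt G₁ s₂
      at-s₂ = edgesAt G₁ s₂ (cubic₁ s₂)
      open EdgesAt at-s₂
      differ : AllDifferent (lookup c ∘ ι ∘ edge)
      differ = parity-lemma G₁ cubic₁ (lookup c ∘ ι) s₂ (ι-proper-off-s₂ c pc) at-s₂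
      same : lookup c (cutEdge zero) ≡ lookup c (cutEdge (suc zero))
      same with Inc⇒edge d d-Inc-s₂
      ... | j , edge-j≡d = sym (remaining-colour (lookup c (ι (edge k))) (lookup c (ι (edge l))) (lookup c (cutEdge zero)) _
            (differ k l o₁≢o₂) (≢-d k o₁≢j) (≢-d l o₂≢j) (new≢ k o₁≢j) (new≢ l o₂≢j))
        where
        k : Fin 3
        k = other₁ j
        l : Fin 3
        l = other₂ j
        o₁≢j : k ≢ j
        o₁≢j = proj₁ (others-distinct j)
        o₂≢j : l ≢ j
        o₂≢j = proj₁ (proj₂ (others-distinct j))
        o₁≢o₂ : k ≢ l
        o₁≢o₂ = proj₂ (proj₂ (others-distinct j))
        ≢-d : ∀ m → m ≢ j → lookup c (ι (edge m)) ≢ lookup c (cutEdge zero)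
        ≢-d m m≢j eq = differ m j m≢j (trans eq (sym (cong (lookup c) (trans (cong ι edge-j≡d) ι-d))))
        new≢ : ∀ m → m ≢ j → lookup c (cutEdge (suc zero)) ≢ lookup c (ι (edge m))
        new≢ m m≢j = pc (cutEdge (suc zero)) (ι (edge m)) (cutEdge≢ι (suc zero) (edge m) edge-m≢d)
            (ShareEnd-sym G (ShareEnd-cutEdge (edge m) (suc zero) edge-m≢d (edge-Inc m)))
          where
          edge-m≢d : edge m ≢ d
          edge-m≢d eq = m≢j (edge-injective m j (trans eq (sym edge-j≡d)))
      all-agree : ∀ i k → lookup c (cutEdge i) ≡ lookup c (cutEdge k)
      all-agree zero zero = refl
      all-agree zero (suc zero) = same
      all-agree (suc zero) zero = sym same
      all-agree (suc zero) (suc zero) = refl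

    Left-ι⁻ : ∀ y → Left (τ y) → Σ (Fin (E G₁)) λ g → g ≢ d × ι g ≡ y
    Left-ι⁻ y ly with τ y in eq
    ... | inj₁ (g , pf) = g , toWitnessFalse pf , τ-injective _ _
          (trans (proj₂ (τ-ι-off g (toWitnessFalse pf))) (trans (cong (λ r → inj₁ (g , r)) (T-irrelevant _ _)) (sym eq)))

    ShareEnd-ι : ∀ g h → g ≢ d → h ≢ d → ShareEnd G₁ g h → ShareEnd G (ι g) (ι h)
    ShareEnd-ι g h g≢d h≢d (u , i , i′) = common-end⇒ShareEnd (ι g) (ι h) (inj₁ u)
      (EndOf-left {ι g} (proj₂ (τ-ι-off g g≢d)) i) (EndOf-left {ι h} (proj₂ (τ-ι-off h h≢d)) i′)

    ShareEnd-ι⁻ : ∀ g h → g ≢ d → h ≢ d → ShareEnd G (ι g) (ι h) → ShareEnd G₁ g h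
    ShareEnd-ι⁻ g h g≢d h≢d sh with ShareEnd⇒common-end (ι g) (ι h) sh
    ... | z , p , q with EndOf-left⁻ {ι g} (proj₂ (τ-ι-off g g≢d)) p | EndOf-left⁻ {ι h} (proj₂ (τ-ι-off h h≢d)) q
    ... | u , refl , i | _ , refl , i′ = u , i , i′

    ShareEnd-port : ∀ g p → g ≢ d → p ≡ d → ShareEnd G₁ g p →
                    Σ (Fin (E G)) λ y → Cross (τ y) × d ≡ p × ShareEnd G (ι g) y
    ShareEnd-port g p g≢d refl (u , i , i′) with d-Inc-only u i′
    ... | inj₁ refl = cutEdge zero , subst Cross (sym (τσ _)) tt , refl , ShareEnd-cutEdge g zero g≢d i
    ... | inj₂ refl = cutEdge (suc zero) , subst Cross (sym (τσ _)) tt , refl , ShareEnd-cutEdge g (suc zero) g≢d i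

    ShareEnd-cut : ∀ g y → g ≢ d → Cross (τ y) → ShareEnd G (ι g) y → ShareEnd G₁ g d
    ShareEnd-cut g y g≢d cy sh with Cross⇒cutEdge y cy
    ... | k , refl with ShareEnd⇒common-end (ι g) (cutEdge k) sh
    ... | z , p , q with EndOf-left⁻ {ι g} (proj₂ (τ-ι-off g g≢d)) p
    ... | u , refl , i with EndOf-cutEdge⁻ k u q
    ... | refl = end k , i , end-Inc k

    cut-colour : ∀ (c : Col₃ G) → Proper G c → ∀ y → Cross (τ y) → lookup c y ≡ lookup c (ι d)
    cut-colour c pc y cy with Cross⇒cutEdge y cy
    ... | k , refl = trans (cut-colours-agree c pc k zero) (cong (lookup c) (sym ι-d))

    -- Otherwise switching the chain of one cut edge would give the two cut edges different colours.
    cuts-linked : ∀ (c : Col₃ G) → Proper G c → ∀ a b → a ≢ b → ∀ x y → Cross (τ x) → Cross (τ y) →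
                  InAB a b (lookup c x) → InAB a b (lookup c y) → Reach G c a b x y
    cuts-linked c pc a b a≢b x y cx cy x∈ab y∈ab with Reach? G c a b x y
    ... | yes r = r
    ... | no ¬r with Cross⇒cutEdge x cx | Cross⇒cutEdge y cy
    ... | i , refl | k , refl with i ≟ k
    ... | yes refl = ⊥-elim (¬r here)
    ... | no _ = ⊥-elim (swapCol-moves a b _ a≢b x∈ab (begin
      swapCol a b (lookup c (cutEdge i)) ≡⟨ proj₁ (proj₂ sw (cutEdge i)) here ⟨
      lookup c′ (cutEdge i)              ≡⟨ cut-colours-agree c′ pc′ i k ⟩
      lookup c′ (cutEdge k)              ≡⟨ proj₂ (proj₂ sw (cutEdge k)) ¬r ⟩
      lookup c (cutEdge k)               ≡⟨ cut-colours-agree c pc i k ⟨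
      lookup c (cutEdge i)               ∎))
      where
      open ≡-Reasoning
      c′ : Col₃ G
      c′ = switchAt G c a b (cutEdge i)
      sw : SwitchAt G c c′ a b (cutEdge i)
      sw = switchAt-SwitchAt G c a b (cutEdge i) x∈ab
      pc′ : Proper G c′
      pc′ = KempeSwitch-Proper G {c′ = c′} pc (a , b , cutEdge i , sw)

    side : CutSide G G₁
    side = record
      { ι = ι ; Port = _≡ d ; Port? = _≟ d
      ; Inner = Left ∘ τ ; Inner? = Left? ∘ τ ; Cut = Cross ∘ τ ; Cut? = Cross? ∘ τ ; cutPort = λ _ → d
      ; ι-Inner = λ g g≢d → subst Left (sym (proj₂ (τ-ι-off g g≢d))) tt
      ; ι-Cut = λ { p refl → subst Cross (sym (trans (cong τ ι-d) (τσ _))) tt }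
      ; Inner-ι⁻ = Left-ι⁻
      ; ι-injective = λ g h _ _ → ι-injective g h
      ; Cut⇒¬Inner = Cross⇒¬Left ∘ τ
      ; cutPort-Port = λ _ _ → refl
      ; cutPort-ι = λ _ p≡d → sym p≡d
      ; ShareEnd-ι⁻ = ShareEnd-ι⁻
      ; ShareEnd-ι = ShareEnd-ι
      ; ShareEnd-port = ShareEnd-port
      ; ShareEnd-cut = ShareEnd-cut
      ; ports-ShareEnd = λ { p q refl refl → proj₁ (ends G₁ d) , inj₁ refl , inj₁ refl }
      ; outer-¬ShareEnd-inner = right-¬ShareEnd-left
      ; cut-colour = cut-colour
      ; ports-coloured-apart = λ { c pc p q refl refl p≢q → ⊥-elim (p≢q refl) }
      ; cuts-linked = cuts-linked
      }

  module _ (G₁ G₂ G : Graph) (q₁ : HPort G₁) (q₂ : HPort G₂) (isH : IsH G₁ G₂ q₁ q₂ G)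
           (cubic₁ : Cubic G₁) (cubic₂ : Cubic G₂) where
    private
      module A = HSide G₁ G₂ G q₁ q₂ isH cubic₁
      module B = HSide G₂ G₁ G q₂ q₁ (swapH isH) cubic₂

    H-decomposition : CutDecomposition G G₁ G₂
    H-decomposition = record
      { S₁ = A.side ; S₂ = B.side
      ; Cut₁⇒Cut₂ = Cross-exchange ∘ A.τ ; Cut₂⇒Cut₁ = Cross-exchange⁻ ∘ A.τ
      ; Inner₁⇒¬Inner₂ = Left⇒¬Left-exchange ∘ A.τ ; outer₁⇒Inner₂ = outer⇒Left-exchange ∘ A.τ }

    -- The two new edges join s₁ to s₁ and s₂ to s₂ across the cut, so they share no end.
    cutEdges-¬ShareEnd : ∀ i k → i ≢ k → ¬ ShareEnd G (A.cutEdge i) (A.cutEdge k)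
    cutEdges-¬ShareEnd i k i≢k sh with A.ShareEnd⇒common-end (A.cutEdge i) (A.cutEdge k) sh
    ... | w , p , q rewrite A.τσ (inj₂ (inj₂ i)) | A.τσ (inj₂ (inj₂ k)) = apart i k i≢k p q
      where
      inj₁-injective : ∀ {x y : Fin (V G₁)} → inj₁ {B = Fin (V G₂)} x ≡ inj₁ y → x ≡ y
      inj₁-injective refl = refl
      inj₂-injective : ∀ {x y : Fin (V G₂)} → inj₂ {A = Fin (V G₁)} x ≡ inj₂ y → x ≡ y
      inj₂-injective refl = refl
      apart : ∀ i k → i ≢ k → EndOf w (hEnds G₁ G₂ q₁ q₂ (inj₂ (inj₂ i))) → EndOf w (hEnds G₁ G₂ q₁ q₂ (inj₂ (inj₂ k))) → ⊥
      apart zero zero i≢k _ _ = i≢k refl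
      apart (suc zero) (suc zero) i≢k _ _ = i≢k refl
      apart zero (suc zero) _ (inj₁ refl) (inj₁ e) = HPortFacts.s₁≢s₂ q₁ (sym (inj₁-injective e))
      apart zero (suc zero) _ (inj₂ refl) (inj₂ e) = HPortFacts.s₁≢s₂ q₂ (sym (inj₂-injective e))
      apart (suc zero) zero _ (inj₁ refl) (inj₁ e) = HPortFacts.s₁≢s₂ q₁ (inj₁-injective e)
      apart (suc zero) zero _ (inj₂ refl) (inj₂ e) = HPortFacts.s₁≢s₂ q₂ (inj₂-injective e)

    H-gluable : Gluable H-decomposition
    H-gluable = record
      { cut-ports-apart = ports-apart ; some-cut = A.cutEdge zero , subst Cross (sym (A.τσ _)) tt ; matching = matching }
      where
      ports-apart : ∀ y z → Cross (A.τ y) → Cross (A.τ z) → y ≢ z → ShareEnd G y z → HPort.d q₁ ≢ HPort.d q₁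
      ports-apart y z cy cz y≢z sh _ with A.Cross⇒cutEdge y cy | A.Cross⇒cutEdge z cz
      ... | i , refl | k , refl = cutEdges-¬ShareEnd i k (y≢z ∘ cong A.cutEdge) sh
      matching : ∀ (c₁ : Col₃ G₁) (c₂ : Col₃ G₂) → Proper G₁ c₁ → Proper G₂ c₂ →
                 Σ Transpositions λ π → Gluing.Compatible H-decomposition c₁ (permuteColouring G₂ π c₂)
      matching c₁ c₂ _ _ = π , λ _ _ → sym (trans (lookup-permuteColouring G₂ π c₂ (HPort.d q₂)) (swapCol-a (lookup c₂ (HPort.d q₂)) (lookup c₁ (HPort.d q₁))))
        where
        π : Transpositions
        π = (lookup c₂ (HPort.d q₂) , lookup c₁ (HPort.d q₁)) ∷ []

    KempeClasses-H : ∀ {a b} → KempeClasses G₁ 3 a → KempeClasses G₂ 3 b → KempeClasses G 3 (a * b)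
    KempeClasses-H = KempeClasses-decomposition H-decomposition H-gluable

theorem3p8 : (G₁ G₂ : Graph) (a b : ℕ) → Cubic G₁ → Cubic G₂ →
    KempeClasses G₁ 3 a → KempeClasses G₂ 3 b →
    ((p₁ : YPort G₁) (p₂ : YPort G₂) (G : Graph) → IsY G₁ G₂ p₁ p₂ G →
       KempeClasses G 3 (a * b)) ×
    ((q₁ : HPort G₁) (q₂ : HPort G₂) (G : Graph) → IsH G₁ G₂ q₁ q₂ G →
       KempeClasses G 3 (a * b))
theorem3p8 G₁ G₂ a b cubic₁ cubic₂ classes₁ classes₂ =
  (λ p₁ p₂ G isY → YComposition.KempeClasses-Y G₁ G₂ G p₁ p₂ isY cubic₁ cubic₂ classes₁ classes₂) ,
  (λ q₁ q₂ G isH → HComposition.KempeClasses-H G₁ G₂ G q₁ q₂ isH cubic₁ cubic₂ classes₁ classes₂)
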